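{- Let $t,k,v$ be integers with $0\le t\le k\le v-t$. Then the Smith normal form of the integer matrix $W_{\overline{t}k}(v)$ is $(I\mid O)$, where $I$ is the identity matrix of order $\binom{v}{t}$ and $O$ is the $\binom{v}{t}\times\left(\binom{v}{k}-\binom{v}{t}\right)$ zero matrix.
   Context: For a positive integer $v$, $[v]=\{1,\dots,v\}$. For a finite set $F=\{a_1<a_2<\dots<a_m\}$ of positive integers define $b_1,\dots,b_m$ recursively by $b_i=\max\big([a_i]\setminus(F\cup\{b_1,\dots,b_{i-1}\})\big)$, where $\max\emptyset$ is a special symbol $\mathfrak{j}$ (and $\mathfrak{j}$ is ignored when it appears in the set $\{b_1,\dots,b_{i-1}\}$). The rank $r(F)$ is the number of indices $i$ with $b_i\neq\mathfrak{j}$; $F$ is full-rank if $r(F)=|F|$ (in particular $\emptyset$ is full-rank). If $F$ is not full-rank, let $i$ be the largest index with $b_i=\mathfrak{j}$ and set $F^-=F\setminus\{a_i\}$. For any finite $F$, $\overline{F}$ denotes the full-rank set obtained from $F$ by applying $F\mapsto F^-$ repeatedly until a full-rank set is reached. For $0\le t\le k\le v$, $W_{\overline{t}k}(v)$ is the $\binom{v}{t}\times\binom{v}{k}$ $0,1$-matrix with rows indexed by the $t$-subsets $T$ of $[v]$ and columns by the $k$-subsets $K$ of $[v]$, whose $(T,K)$ entry is $1$ iff $\overline{T}\subseteq K$. The Smith normal form of an integer matrix $A$ is the matrix $(D\mid O)$ with $D=\mathrm{diag}(d_1,\dots,d_r)$, $d_i>0$, $d_1\mid\cdots\mid d_r$,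 such that $UAV=(D\mid O)$ for some unimodular $U,V$. -}

module Defs where

open import Data.Nat using (ℕ; zero; suc; _≡ᵇ_)
open import Data.Bool using (Bool; true; false; if_then_else_; _∨_)
open import Data.List using (List; []; _∷_; _++_; map; length; lookup)
open import Data.Bool.ListAction using (any; all)
open import Data.Maybe using (Maybe; just; nothing; maybe)
open import Data.Fin using (Fin; toℕ)
open import Data.Integer using (ℤ; 0ℤ; 1ℤ; _+_; _*_)
open import Relation.Binary.PropositionalEquality using (_≡_)
open import Data.Product using (Σ; _×_)

-- Finite sets of positive integers are represented as strictly
-- increasing lists of ℕ.

mem : ℕ → List ℕ → Bool
mem x xs = any (λ y → x ≡ᵇ y) xs

ksubsets : ℕ → ℕ → List (List ℕ)
ksubsets zero    zero    = [] ∷ []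
ksubsets zero    (suc k) = []
ksubsets (suc v) zero    = [] ∷ []
ksubsets (suc v) (suc k) =
  ksubsets v (suc k) ++ map (λ S → S ++ (suc v ∷ [])) (ksubsets v k)

-- max ([n] \ {x | ex x}) ; nothing plays the role of the symbol 𝔧
maxAvail : ℕ → (ℕ → Bool) → Maybe ℕ
maxAvail zero    ex = nothing
maxAvail (suc n) ex = if ex (suc n) then maxAvail n ex else just (suc n)

-- the sequence b_1, …, b_m of F = {a_1 < … < a_m}
-- (the accumulator holds the b_j ≠ 𝔧 found so far)
bseqGo : List ℕ → List ℕ → List ℕ → List (Maybe ℕ)
bseqGo F used []       = []
bseqGo F used (a ∷ as) =
  let b = maxAvail a (λ x → mem x F ∨ mem x used)
  in b ∷ bseqGo F (maybe (λ y → y ∷ used) used b) as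

bseq : List ℕ → List (Maybe ℕ)
bseq F = bseqGo F [] F

rank : List ℕ → ℕ
rank F = go (bseq F)
  where
  go : List (Maybe ℕ) → ℕ
  go []              = zero
  go (just _  ∷ bs)  = suc (go bs)
  go (nothing ∷ bs)  = go bs

-- (0-based) position of the last 𝔧 in the b-sequence, if any
lastNothing : ℕ → Maybe ℕ → List (Maybe ℕ) → Maybe ℕ
lastNothing i acc []             = acc
lastNothing i acc (nothing ∷ bs) = lastNothing (suc i) (just i) bs
lastNothing i acc (just _ ∷ bs)  = lastNothing (suc i) acc bs

removeAt : ℕ → List ℕ → List ℕ
removeAt i       []       = []
removeAt zero    (x ∷ xs) = xs
removeAt (suc i) (x ∷ xs) = x ∷ removeAt i xs

-- F ↦ F⁻ (defined to be F itself when F is full-rank, i.e. no 𝔧 occurs)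
minus : List ℕ → List ℕ
minus F = maybe (λ i → removeAt i F) F (lastNothing zero nothing (bseq F))

iter : ℕ → (List ℕ → List ℕ) → List ℕ → List ℕ
iter zero    f x = x
iter (suc n) f x = iter n f (f x)

-- F̄ : apply F ↦ F⁻ until full rank; each proper step removes an element,
-- and full-rank sets are fixed by `minus`, so |F| iterations suffice.
bar : List ℕ → List ℕ
bar F = iter (length F) minus F

subsetᵇ : List ℕ → List ℕ → Bool
subsetᵇ A B = all (λ x → mem x B) A

Matrix : ℕ → ℕ → Set
Matrix m n = Fin m → Fin n → ℤ

sumFin : (n : ℕ) → (Fin n → ℤ) → ℤ
sumFin zero    f = 0ℤ
sumFin (suc n) f = f Fin.zero + sumFin n (λ i → f (Fin.suc i))

_⊗_ : ∀ {m n p} → Matrix m n → Matrix n p → Matrix m p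
_⊗_ {n = n} A B i j = sumFin n (λ l → A i l * B l j)

IO : (m n : ℕ) → Matrix m n
IO m n i j = if toℕ i ≡ᵇ toℕ j then 1ℤ else 0ℤ

identity : (n : ℕ) → Matrix n n
identity n = IO n n

Unimodular : ∀ {n} → Matrix n n → Set
Unimodular {n} U = Σ (Matrix n n) λ U′ →
  ((∀ i j → (U ⊗ U′) i j ≡ identity n i j) × (∀ i j → (U′ ⊗ U) i j ≡ identity n i j))

-- Smith normal form of A is (I | O) : U A V = (I | O), U, V unimodular.
-- (By uniqueness of the Smith normal form this characterizes it.)
SNFisIO : ∀ {m n} → Matrix m n → Set
SNFisIO {m} {n} A = Σ (Matrix m m) λ U → Σ (Matrix n n) λ V →
  Unimodular U × Unimodular V × (∀ i j → ((U ⊗ A) ⊗ V) i j ≡ IO m n i j)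

rowsW : ℕ → ℕ → ℕ
rowsW v t = length (ksubsets v t)

W : (t k v : ℕ) → Matrix (length (ksubsets v t)) (length (ksubsets v k))
W t k v T K =
  if subsetᵇ (bar (lookup (ksubsets v t) T)) (lookup (ksubsets v k) K) then 1ℤ else 0ℤ

module Submission where

-- Induction on v, splitting the t-subsets and k-subsets of [v] by whether they
-- contain v. The closure is computed through a counting model: b_i = 𝔧 exactly
-- when no number below a_i is still free, which depends only on the gaps between
-- the a_i, and F̄ consists of the a_i with b_i ≠ 𝔧. Hence for S ⊆ [v-1] with
-- 2|S| < v - 1 the closure of S ∪ {v} is S̄ ∪ {v}, and W_{t̄k}(v) is, up to
-- reordering, block upper triangular with diagonal blocks W_{t̄k}(v-1) and
-- W_{t-1,k-1}(v-1) and off-diagonal block W_{t̄,k-1}(v-1). If k + t < v both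
-- diagonal blocks have Smith form (I | O) by induction, and such block triangular
-- matrices inherit it. If k + t = v, every (t-1)-set S is R⁻ for a t-set
-- R ⊆ [v-1] with R̄ = S̄; row operations then give [A, B; -A′, 0] with B and A′
-- reindexings of W_{t̄,k-1}(v-1) (of W_{t-1,k-1}(v-1) when t = k) and of
-- W_{t-1,k}(v-1), again covered by induction.

open import Data.Nat using (ℕ)
open import Defs

module NatTests where

  open import Data.Nat using (ℕ; zero; suc; _+_; _∸_; _≡ᵇ_; _<ᵇ_; _<_; _<?_; _≟_)
  open import Data.Nat.Properties using (<⇒<ᵇ; <ᵇ⇒<; ≡ᵇ⇒≡; ≮⇒≥; m+[n∸m]≡n)
  open import Data.Bool using (true; false; T)
  open import Data.Empty using (⊥-elim)
  open import Data.Product using (∃; _,_)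
  open import Data.Sum using (_⊎_; inj₁; inj₂)
  open import Function using (Injective)
  open import Relation.Binary.PropositionalEquality
  open import Relation.Nullary using (¬_; yes; no)

  ≡ᵇ-refl : ∀ n → (n ≡ᵇ n) ≡ true
  ≡ᵇ-refl zero    = refl
  ≡ᵇ-refl (suc n) = ≡ᵇ-refl n

  ≢⇒≡ᵇ≡false : ∀ {m n} → ¬ m ≡ n → (m ≡ᵇ n) ≡ false
  ≢⇒≡ᵇ≡false {m} {n} m≢n with m ≡ᵇ n in eq
  ... | true  = ⊥-elim (m≢n (≡ᵇ⇒≡ m n (subst T (sym eq) _)))
  ... | false = refl

  ≡ᵇ-comm : ∀ m n → (m ≡ᵇ n) ≡ (n ≡ᵇ m)
  ≡ᵇ-comm zero    zero    = refl
  ≡ᵇ-comm zero    (suc n) = refl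
  ≡ᵇ-comm (suc m) zero    = refl
  ≡ᵇ-comm (suc m) (suc n) = ≡ᵇ-comm m n

  ≡ᵇ-+ : ∀ k m n → (k + m ≡ᵇ k + n) ≡ (m ≡ᵇ n)
  ≡ᵇ-+ zero    m n = refl
  ≡ᵇ-+ (suc k) m n = ≡ᵇ-+ k m n

  ≡ᵇ-injective : ∀ (f : ℕ → ℕ) → Injective _≡_ _≡_ f → ∀ m n → (f m ≡ᵇ f n) ≡ (m ≡ᵇ n)
  ≡ᵇ-injective f f-inj m n with m ≟ n
  ... | yes refl = trans (≡ᵇ-refl (f m)) (sym (≡ᵇ-refl m))
  ... | no m≢n   = trans (≢⇒≡ᵇ≡false (λ e → m≢n (f-inj e))) (sym (≢⇒≡ᵇ≡false m≢n))

  <⇒<ᵇ≡true : ∀ {m n} → m < n → (m <ᵇ n) ≡ true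
  <⇒<ᵇ≡true {m} {n} m<n with m <ᵇ n | <⇒<ᵇ m<n
  ... | true | _ = refl

  <ᵇ≡true⇒< : ∀ m n → (m <ᵇ n) ≡ true → m < n
  <ᵇ≡true⇒< m n e = <ᵇ⇒< m n (subst T (sym e) _)

  <ᵇ≡false⇒≮ : ∀ m n → (m <ᵇ n) ≡ false → ¬ m < n
  <ᵇ≡false⇒≮ m n e m<n = subst T e (<⇒<ᵇ m<n)

  ≮⇒<ᵇ≡false : ∀ {m n} → ¬ m < n → (m <ᵇ n) ≡ false
  ≮⇒<ᵇ≡false {m} {n} m≮n with m <ᵇ n in eq
  ... | true  = ⊥-elim (m≮n (<ᵇ≡true⇒< m n eq))
  ... | false = refl

  <-or-offset : ∀ p x → x < p ⊎ ∃ λ y → x ≡ p + y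
  <-or-offset p x with x <? p
  ... | yes x<p = inj₁ x<p
  ... | no  x≮p = inj₂ (x ∸ p , sym (m+[n∸m]≡n (≮⇒≥ x≮p)))


-- σ exchanges the adjacent intervals [m₁, m₁ + m₂) and [m₁ + m₂, m₁ + m₂ + a),
-- keeping the order inside each of them; τ is its inverse.
module Interchange (m₁ a m₂ : ℕ) where

  open import Data.Nat using (ℕ; _+_; _∸_; _<ᵇ_; _≤_; _<_)
  open import Data.Nat.Properties
  open import Data.Bool using (if_then_else_)
  open import Data.Fin using (Fin; toℕ; fromℕ<)
  open import Data.Fin.Properties using (toℕ-fromℕ<; toℕ<n; toℕ-injective)
  open import Data.Sum using (inj₁; inj₂)
  open import Data.Product using (_,_)
  open import Relation.Binary.PropositionalEquality
  open NatTests

  σ : ℕ → ℕ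
  σ x = if x <ᵇ m₁ then x else
        if x ∸ m₁ <ᵇ m₂ then m₁ + (a + (x ∸ m₁)) else
        if x ∸ m₁ ∸ m₂ <ᵇ a then m₁ + (x ∸ m₁ ∸ m₂) else x

  τ : ℕ → ℕ
  τ x = if x <ᵇ m₁ then x else
        if x ∸ m₁ <ᵇ a then m₁ + (m₂ + (x ∸ m₁)) else
        if x ∸ m₁ ∸ a <ᵇ m₂ then m₁ + (x ∸ m₁ ∸ a) else x

  σ-prefix : ∀ x → x < m₁ → σ x ≡ x
  σ-prefix x x<m₁ rewrite <⇒<ᵇ≡true x<m₁ = refl

  σ-first : ∀ y → y < m₂ → σ (m₁ + y) ≡ m₁ + (a + y)
  σ-first y y<m₂ rewrite ≮⇒<ᵇ≡false (m+n≮m m₁ y) | m+n∸m≡n m₁ y | <⇒<ᵇ≡true y<m₂ = refl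

  σ-second : ∀ z → z < a → σ (m₁ + (m₂ + z)) ≡ m₁ + z
  σ-second z z<a
    rewrite ≮⇒<ᵇ≡false (m+n≮m m₁ (m₂ + z)) | m+n∸m≡n m₁ (m₂ + z)
          | ≮⇒<ᵇ≡false (m+n≮m m₂ z) | m+n∸m≡n m₂ z | <⇒<ᵇ≡true z<a = refl

  σ-suffix : ∀ w → σ (m₁ + (m₂ + (a + w))) ≡ m₁ + (m₂ + (a + w))
  σ-suffix w
    rewrite ≮⇒<ᵇ≡false (m+n≮m m₁ (m₂ + (a + w))) | m+n∸m≡n m₁ (m₂ + (a + w))
          | ≮⇒<ᵇ≡false (m+n≮m m₂ (a + w)) | m+n∸m≡n m₂ (a + w) | ≮⇒<ᵇ≡false (m+n≮m a w) = refl

  τ-prefix : ∀ x → x < m₁ → τ x ≡ x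
  τ-prefix x x<m₁ rewrite <⇒<ᵇ≡true x<m₁ = refl

  τ-first : ∀ z → z < a → τ (m₁ + z) ≡ m₁ + (m₂ + z)
  τ-first z z<a rewrite ≮⇒<ᵇ≡false (m+n≮m m₁ z) | m+n∸m≡n m₁ z | <⇒<ᵇ≡true z<a = refl

  τ-second : ∀ y → y < m₂ → τ (m₁ + (a + y)) ≡ m₁ + y
  τ-second y y<m₂
    rewrite ≮⇒<ᵇ≡false (m+n≮m m₁ (a + y)) | m+n∸m≡n m₁ (a + y)
          | ≮⇒<ᵇ≡false (m+n≮m a y) | m+n∸m≡n a y | <⇒<ᵇ≡true y<m₂ = refl

  τ-suffix : ∀ w → τ (m₁ + (a + (m₂ + w))) ≡ m₁ + (a + (m₂ + w))
  τ-suffix w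
    rewrite ≮⇒<ᵇ≡false (m+n≮m m₁ (a + (m₂ + w))) | m+n∸m≡n m₁ (a + (m₂ + w))
          | ≮⇒<ᵇ≡false (m+n≮m a (m₂ + w)) | m+n∸m≡n a (m₂ + w) | ≮⇒<ᵇ≡false (m+n≮m m₂ w) = refl

  suffix-comm : ∀ w → m₁ + (m₂ + (a + w)) ≡ m₁ + (a + (m₂ + w))
  suffix-comm w = cong (m₁ +_) (x+[y+z]≡y+[x+z] m₂ a w)
    where open import Data.Nat.Tactic.RingSolver using (solve-∀)
          x+[y+z]≡y+[x+z] : ∀ x y z → x + (y + z) ≡ y + (x + z)
          x+[y+z]≡y+[x+z] = solve-∀

  data σ-View : ℕ → Set where
    prefix : ∀ x → x < m₁ → σ-View x
    first  : ∀ y → y < m₂ → σ-View (m₁ + y)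
    second : ∀ z → z < a → σ-View (m₁ + (m₂ + z))
    suffix : ∀ w → σ-View (m₁ + (m₂ + (a + w)))

  σ-view : ∀ x → σ-View x
  σ-view x with <-or-offset m₁ x
  ... | inj₁ x<m₁ = prefix x x<m₁
  ... | inj₂ (y , refl) with <-or-offset m₂ y
  ...   | inj₁ y<m₂ = first y y<m₂
  ...   | inj₂ (z , refl) with <-or-offset a z
  ...     | inj₁ z<a = second z z<a
  ...     | inj₂ (w , refl) = suffix w

  data τ-View : ℕ → Set where
    prefix : ∀ x → x < m₁ → τ-View x
    first  : ∀ z → z < a → τ-View (m₁ + z)
    second : ∀ y → y < m₂ → τ-View (m₁ + (a + y))
    suffix : ∀ w → τ-View (m₁ + (a + (m₂ + w)))

  τ-view : ∀ x → τ-View x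
  τ-view x with <-or-offset m₁ x
  ... | inj₁ x<m₁ = prefix x x<m₁
  ... | inj₂ (z , refl) with <-or-offset a z
  ...   | inj₁ z<a = first z z<a
  ...   | inj₂ (y , refl) with <-or-offset m₂ y
  ...     | inj₁ y<m₂ = second y y<m₂
  ...     | inj₂ (w , refl) = suffix w

  τ∘σ : ∀ x → τ (σ x) ≡ x
  τ∘σ x with σ-view x
  ... | prefix x l = trans (cong τ (σ-prefix x l)) (τ-prefix x l)
  ... | first y l  = trans (cong τ (σ-first y l)) (τ-second y l)
  ... | second z l = trans (cong τ (σ-second z l)) (τ-first z l)
  ... | suffix w   = trans (cong τ (trans (σ-suffix w) (suffix-comm w)))
                           (trans (τ-suffix w) (sym (suffix-comm w)))

  σ∘τ : ∀ x → σ (τ x) ≡ x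
  σ∘τ x with τ-view x
  ... | prefix x l = trans (cong σ (τ-prefix x l)) (σ-prefix x l)
  ... | first z l  = trans (cong σ (τ-first z l)) (σ-second z l)
  ... | second y l = trans (cong σ (τ-second y l)) (σ-first y l)
  ... | suffix w   = trans (cong σ (trans (τ-suffix w) (sym (suffix-comm w))))
                           (trans (σ-suffix w) (suffix-comm w))

  σ-injective : ∀ {x y} → σ x ≡ σ y → x ≡ y
  σ-injective {x} {y} e = trans (sym (τ∘σ x)) (trans (cong τ e) (τ∘σ y))

  module OnFin {N : ℕ} (fits : m₁ + (a + m₂) ≤ N) where

    σ-< : ∀ x → x < N → σ x < N
    σ-< x x<N with σ-view x
    ... | prefix x l = subst (_< N) (sym (σ-prefix x l)) x<N
    ... | first y l  = subst (_< N) (sym (σ-first y l))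
                         (<-≤-trans (+-monoʳ-< m₁ (+-monoʳ-< a l)) fits)
    ... | second z l = subst (_< N) (sym (σ-second z l))
                         (≤-<-trans (+-monoʳ-≤ m₁ (m≤n+m z m₂)) x<N)
    ... | suffix w   = subst (_< N) (sym (σ-suffix w)) x<N

    τ-< : ∀ x → x < N → τ x < N
    τ-< x x<N with τ-view x
    ... | prefix x l = subst (_< N) (sym (τ-prefix x l)) x<N
    ... | first z l  = subst (_< N) (sym (τ-first z l))
                         (<-≤-trans (+-monoʳ-< m₁ (subst (m₂ + z <_) (+-comm m₂ a) (+-monoʳ-< m₂ l))) fits)
    ... | second y l = subst (_< N) (sym (τ-second y l))
                         (≤-<-trans (+-monoʳ-≤ m₁ (m≤n+m y a)) x<N)
    ... | suffix w   = subst (_< N) (sym (τ-suffix w)) x<N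

    σᶠ : Fin N → Fin N
    σᶠ j = fromℕ< (σ-< (toℕ j) (toℕ<n j))

    τᶠ : Fin N → Fin N
    τᶠ j = fromℕ< (τ-< (toℕ j) (toℕ<n j))

    toℕ-σᶠ : ∀ j → toℕ (σᶠ j) ≡ σ (toℕ j)
    toℕ-σᶠ j = toℕ-fromℕ< _

    σᶠ∘τᶠ : ∀ j → σᶠ (τᶠ j) ≡ j
    σᶠ∘τᶠ j = toℕ-injective (trans (toℕ-fromℕ< _) (trans (cong σ (toℕ-fromℕ< _)) (σ∘τ (toℕ j))))

    τᶠ∘σᶠ : ∀ j → τᶠ (σᶠ j) ≡ j
    τᶠ∘σᶠ j = toℕ-injective (trans (toℕ-fromℕ< _) (trans (cong τ (toℕ-fromℕ< _)) (τ∘σ (toℕ j))))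


module Matrices where

  open import Data.Nat as ℕ using (ℕ; zero; suc)
  open import Data.Bool using (Bool; if_then_else_)
  open import Data.Fin using (Fin; _↑ˡ_; _↑ʳ_)
  import Data.Fin as Fin
  open import Data.Integer using (ℤ; 0ℤ; 1ℤ; _+_; _*_; -_)
  import Data.Integer.Properties as ℤ
  open import Algebra.Properties.Semiring.Sum ℤ.+-*-semiring
    using (sum; sum-cong-≗; ∑-comm; *-distribˡ-sum; *-distribʳ-sum)
  open import Data.Product using (_,_)
  open import Function using (_∘_)
  open import Relation.Binary.PropositionalEquality

  infix 4 _≐_
  _≐_ : ∀ {m n} → Matrix m n → Matrix m n → Set
  A ≐ B = ∀ i j → A i j ≡ B i j

  ≐-refl : ∀ {m n} {A : Matrix m n} → A ≐ A
  ≐-refl _ _ = refl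

  ≐-sym : ∀ {m n} {A B : Matrix m n} → A ≐ B → B ≐ A
  ≐-sym e i j = sym (e i j)

  ≐-trans : ∀ {m n} {A B C : Matrix m n} → A ≐ B → B ≐ C → A ≐ C
  ≐-trans e f i j = trans (e i j) (f i j)

  𝟙 : Bool → ℤ
  𝟙 b = if b then 1ℤ else 0ℤ

  δ : ∀ {m n} → Fin m → Fin n → ℤ
  δ {m} {n} = IO m n

  0M : ∀ {m n} → Matrix m n
  0M _ _ = 0ℤ

  infixl 6 _+M_
  _+M_ : ∀ {m n} → Matrix m n → Matrix m n → Matrix m n
  (A +M B) i j = A i j + B i j

  neg : ∀ {m n} → Matrix m n → Matrix m n
  neg A i j = - A i j

  sumFin-cong : ∀ n {f g : Fin n → ℤ} → (∀ i → f i ≡ g i) → sumFin n f ≡ sumFin n g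
  sumFin-cong zero    e = refl
  sumFin-cong (suc n) e = cong₂ _+_ (e Fin.zero) (sumFin-cong n (e ∘ Fin.suc))

  sumFin-zero : ∀ n {f : Fin n → ℤ} → (∀ i → f i ≡ 0ℤ) → sumFin n f ≡ 0ℤ
  sumFin-zero zero    e = refl
  sumFin-zero (suc n) e = cong₂ _+_ (e Fin.zero) (sumFin-zero n (e ∘ Fin.suc))

  sumFin≡sum : ∀ n (f : Fin n → ℤ) → sumFin n f ≡ sum f
  sumFin≡sum zero    f = refl
  sumFin≡sum (suc n) f = cong (f Fin.zero +_) (sumFin≡sum n (f ∘ Fin.suc))

  sumFin-neg : ∀ n (f : Fin n → ℤ) → - sumFin n f ≡ sumFin n (λ i → - f i)
  sumFin-neg zero    f = refl
  sumFin-neg (suc n) f =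
    trans (ℤ.neg-distrib-+ (f Fin.zero) _) (cong (- f Fin.zero +_) (sumFin-neg n (f ∘ Fin.suc)))

  sumFin-δˡ : ∀ n (i : Fin n) (f : Fin n → ℤ) → sumFin n (λ l → δ i l * f l) ≡ f i
  sumFin-δˡ (suc n) Fin.zero f =
    trans (cong (1ℤ * f Fin.zero +_) (sumFin-zero n (λ _ → refl)))
          (trans (ℤ.+-identityʳ _) (ℤ.*-identityˡ _))
  sumFin-δˡ (suc n) (Fin.suc i) f = trans (ℤ.+-identityˡ _) (sumFin-δˡ n i (f ∘ Fin.suc))

  sumFin-δʳ : ∀ n (j : Fin n) (f : Fin n → ℤ) → sumFin n (λ l → f l * δ l j) ≡ f j
  sumFin-δʳ (suc n) Fin.zero f =
    trans (cong (f Fin.zero * 1ℤ +_) (sumFin-zero n (λ l → ℤ.*-zeroʳ (f (Fin.suc l)))))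
          (trans (ℤ.+-identityʳ _) (ℤ.*-identityʳ _))
  sumFin-δʳ (suc n) (Fin.suc j) f =
    trans (cong (_+ sumFin n (λ l → f (Fin.suc l) * δ l j)) (ℤ.*-zeroʳ (f Fin.zero)))
          (trans (ℤ.+-identityˡ _) (sumFin-δʳ n j (f ∘ Fin.suc)))

  sumFin-++ : ∀ m n (f : Fin (m ℕ.+ n) → ℤ) →
    sumFin (m ℕ.+ n) f ≡ sumFin m (λ i → f (i ↑ˡ n)) + sumFin n (λ j → f (m ↑ʳ j))
  sumFin-++ zero    n f = sym (ℤ.+-identityˡ _)
  sumFin-++ (suc m) n f =
    trans (cong (f Fin.zero +_) (sumFin-++ m n (f ∘ Fin.suc))) (sym (ℤ.+-assoc (f Fin.zero) _ _))

  ⊗-cong : ∀ {m n p} {A A′ : Matrix m n} {B B′ : Matrix n p} → A ≐ A′ → B ≐ B′ → (A ⊗ B) ≐ (A′ ⊗ B′)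
  ⊗-cong {n = n} eA eB i j = sumFin-cong n (λ l → cong₂ _*_ (eA i l) (eB l j))

  ⊗-congˡ : ∀ {m n p} (A : Matrix m n) {B B′ : Matrix n p} → B ≐ B′ → (A ⊗ B) ≐ (A ⊗ B′)
  ⊗-congˡ A eB = ⊗-cong {A = A} ≐-refl eB

  ⊗-congʳ : ∀ {m n p} (B : Matrix n p) {A A′ : Matrix m n} → A ≐ A′ → (A ⊗ B) ≐ (A′ ⊗ B)
  ⊗-congʳ B eA = ⊗-cong {B = B} eA ≐-refl

  ⊗-sum : ∀ {m n p} (A : Matrix m n) (B : Matrix n p) i j → (A ⊗ B) i j ≡ sum (λ l → A i l * B l j)
  ⊗-sum {n = n} A B i j = sumFin≡sum n _

  ⊗-assoc : ∀ {m n p q} (A : Matrix m n) (B : Matrix n p) (C : Matrix p q) →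
    ((A ⊗ B) ⊗ C) ≐ (A ⊗ (B ⊗ C))
  ⊗-assoc A B C i j = begin
    ((A ⊗ B) ⊗ C) i j                               ≡⟨ ⊗-sum (A ⊗ B) C i j ⟩
    sum (λ l → (A ⊗ B) i l * C l j)                 ≡⟨ sum-cong-≗ (λ l → cong (_* C l j) (⊗-sum A B i l)) ⟩
    sum (λ l → sum (λ r → A i r * B r l) * C l j)
      ≡⟨ sum-cong-≗ (λ l → *-distribʳ-sum (C l j) (λ r → A i r * B r l)) ⟩
    sum (λ l → sum (λ r → A i r * B r l * C l j))   ≡⟨ ∑-comm (λ l r → A i r * B r l * C l j) ⟩
    sum (λ r → sum (λ l → A i r * B r l * C l j))
      ≡⟨ sum-cong-≗ (λ r → sum-cong-≗ (λ l → ℤ.*-assoc (A i r) (B r l) (C l j))) ⟩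
    sum (λ r → sum (λ l → A i r * (B r l * C l j)))
      ≡⟨ sum-cong-≗ (λ r → sym (*-distribˡ-sum (A i r) (λ l → B r l * C l j))) ⟩
    sum (λ r → A i r * sum (λ l → B r l * C l j))   ≡⟨ sum-cong-≗ (λ r → cong (A i r *_) (sym (⊗-sum B C r j))) ⟩
    sum (λ r → A i r * (B ⊗ C) r j)                 ≡⟨ sym (⊗-sum A (B ⊗ C) i j) ⟩
    (A ⊗ (B ⊗ C)) i j                               ∎
    where open ≡-Reasoning

  ⊗-identityˡ : ∀ {m n} (A : Matrix m n) → (identity m ⊗ A) ≐ A
  ⊗-identityˡ {m} A i j = sumFin-δˡ m i (λ l → A l j)

  ⊗-identityʳ : ∀ {m n} (A : Matrix m n) → (A ⊗ identity n) ≐ A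
  ⊗-identityʳ {n = n} A i j = sumFin-δʳ n j (A i)

  ⊗-zeroˡ : ∀ {m n p} (A : Matrix n p) → (0M {m} ⊗ A) ≐ 0M
  ⊗-zeroˡ {n = n} A i j = sumFin-zero n (λ _ → refl)

  ⊗-zeroʳ : ∀ {m n p} (A : Matrix m n) → (A ⊗ 0M {n} {p}) ≐ 0M
  ⊗-zeroʳ {n = n} A i j = sumFin-zero n (λ l → ℤ.*-zeroʳ (A i l))

  ⊗-negˡ : ∀ {m n p} (A : Matrix m n) (B : Matrix n p) → (neg A ⊗ B) ≐ neg (A ⊗ B)
  ⊗-negˡ {n = n} A B i j =
    trans (sumFin-cong n (λ l → sym (ℤ.neg-distribˡ-* (A i l) (B l j)))) (sym (sumFin-neg n _))

  ⊗-negʳ : ∀ {m n p} (A : Matrix m n) (B : Matrix n p) → (A ⊗ neg B) ≐ neg (A ⊗ B)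
  ⊗-negʳ {n = n} A B i j =
    trans (sumFin-cong n (λ l → sym (ℤ.neg-distribʳ-* (A i l) (B l j)))) (sym (sumFin-neg n _))

  ⊗-neg-neg : ∀ {m n p} (A : Matrix m n) (B : Matrix n p) → (neg A ⊗ neg B) ≐ (A ⊗ B)
  ⊗-neg-neg A B i j =
    trans (⊗-negˡ A (neg B) i j) (trans (cong -_ (⊗-negʳ A B i j)) (ℤ.neg-involutive _))

  unimodular-identity : ∀ n → Unimodular (identity n)
  unimodular-identity n = identity n , ⊗-identityˡ (identity n) , ⊗-identityˡ (identity n)

  unimodular-⊗ : ∀ {n} {U V : Matrix n n} → Unimodular U → Unimodular V → Unimodular (U ⊗ V)
  unimodular-⊗ {n} {U} {V} (U⁻¹ , UU⁻¹ , U⁻¹U) (V⁻¹ , VV⁻¹ , V⁻¹V) =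
    V⁻¹ ⊗ U⁻¹ , cancel U V V⁻¹ U⁻¹ VV⁻¹ UU⁻¹ , cancel V⁻¹ U⁻¹ U V U⁻¹U V⁻¹V
    where
    cancel : ∀ (X Y Y′ X′ : Matrix n n) → (Y ⊗ Y′) ≐ identity n → (X ⊗ X′) ≐ identity n →
             ((X ⊗ Y) ⊗ (Y′ ⊗ X′)) ≐ identity n
    cancel X Y Y′ X′ YY′ XX′ =
      ≐-trans (⊗-assoc X Y (Y′ ⊗ X′))
      (≐-trans (⊗-congˡ X (≐-sym (⊗-assoc Y Y′ X′)))
      (≐-trans (⊗-congˡ X (≐-trans (⊗-congʳ X′ YY′) (⊗-identityˡ X′))) XX′))

  unimodular-neg : ∀ {n} {U : Matrix n n} → Unimodular U → Unimodular (neg U)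
  unimodular-neg {U = U} (U⁻¹ , UU⁻¹ , U⁻¹U) =
    neg U⁻¹ , ≐-trans (⊗-neg-neg U U⁻¹) UU⁻¹ , ≐-trans (⊗-neg-neg U⁻¹ U) U⁻¹U


module Blocks where

  open import Data.Nat as ℕ using (ℕ; _≡ᵇ_; _<_)
  import Data.Nat.Properties as ℕ
  open import Data.Fin using (Fin; toℕ; _↑ˡ_; _↑ʳ_; splitAt)
  open import Data.Fin.Properties
    using (splitAt-↑ˡ; splitAt-↑ʳ; splitAt⁻¹-↑ˡ; splitAt⁻¹-↑ʳ; toℕ-↑ˡ; toℕ-↑ʳ; toℕ<n)
  open import Data.Integer using (0ℤ; _+_)
  import Data.Integer.Properties as ℤ
  open import Data.Sum using (inj₁; inj₂; [_,_]′)
  open import Data.Product using (_,_)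
  open import Relation.Binary.PropositionalEquality
  open import Relation.Nullary using (¬_)
  open NatTests
  open Matrices

  𝟙-≡ᵇ-cong : ∀ {x y x′ y′} → x ≡ x′ → y ≡ y′ → 𝟙 (x ≡ᵇ y) ≡ 𝟙 (x′ ≡ᵇ y′)
  𝟙-≡ᵇ-cong ex ey = cong 𝟙 (cong₂ _≡ᵇ_ ex ey)

  𝟙-≢ : ∀ {x y} → ¬ x ≡ y → 𝟙 (x ≡ᵇ y) ≡ 0ℤ
  𝟙-≢ x≢y = cong 𝟙 (≢⇒≡ᵇ≡false x≢y)

  data SplitView (m n : ℕ) : Fin (m ℕ.+ n) → Set where
    left  : ∀ i → SplitView m n (i ↑ˡ n)
    right : ∀ i → SplitView m n (m ↑ʳ i)

  split-view : ∀ m n i → SplitView m n i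
  split-view m n i with splitAt m i in eq
  ... | inj₁ i′ = subst (SplitView m n) (splitAt⁻¹-↑ˡ eq) (left i′)
  ... | inj₂ i′ = subst (SplitView m n) (splitAt⁻¹-↑ʳ eq) (right i′)

  block : ∀ {m₁ m₂ n₁ n₂} → Matrix m₁ n₁ → Matrix m₁ n₂ → Matrix m₂ n₁ → Matrix m₂ n₂ →
          Matrix (m₁ ℕ.+ m₂) (n₁ ℕ.+ n₂)
  block {m₁} {n₁ = n₁} A B C D i j =
    [ (λ i → [ A i , B i ]′ (splitAt n₁ j)) , (λ i → [ C i , D i ]′ (splitAt n₁ j)) ]′ (splitAt m₁ i)

  module _ {m₁ m₂ n₁ n₂} (A : Matrix m₁ n₁) (B : Matrix m₁ n₂) (C : Matrix m₂ n₁) (D : Matrix m₂ n₂) where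

    block-₁₁ : ∀ i j → block A B C D (i ↑ˡ m₂) (j ↑ˡ n₂) ≡ A i j
    block-₁₁ i j rewrite splitAt-↑ˡ m₁ i m₂ | splitAt-↑ˡ n₁ j n₂ = refl

    block-₁₂ : ∀ i j → block A B C D (i ↑ˡ m₂) (n₁ ↑ʳ j) ≡ B i j
    block-₁₂ i j rewrite splitAt-↑ˡ m₁ i m₂ | splitAt-↑ʳ n₁ n₂ j = refl

    block-₂₁ : ∀ i j → block A B C D (m₁ ↑ʳ i) (j ↑ˡ n₂) ≡ C i j
    block-₂₁ i j rewrite splitAt-↑ʳ m₁ m₂ i | splitAt-↑ˡ n₁ j n₂ = refl

    block-₂₂ : ∀ i j → block A B C D (m₁ ↑ʳ i) (n₁ ↑ʳ j) ≡ D i j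
    block-₂₂ i j rewrite splitAt-↑ʳ m₁ m₂ i | splitAt-↑ʳ n₁ n₂ j = refl

  block-ext : ∀ {m₁ m₂ n₁ n₂} {M N : Matrix (m₁ ℕ.+ m₂) (n₁ ℕ.+ n₂)} →
    (∀ i j → M (i ↑ˡ m₂) (j ↑ˡ n₂) ≡ N (i ↑ˡ m₂) (j ↑ˡ n₂)) →
    (∀ i j → M (i ↑ˡ m₂) (n₁ ↑ʳ j) ≡ N (i ↑ˡ m₂) (n₁ ↑ʳ j)) →
    (∀ i j → M (m₁ ↑ʳ i) (j ↑ˡ n₂) ≡ N (m₁ ↑ʳ i) (j ↑ˡ n₂)) →
    (∀ i j → M (m₁ ↑ʳ i) (n₁ ↑ʳ j) ≡ N (m₁ ↑ʳ i) (n₁ ↑ʳ j)) → M ≐ N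
  block-ext {m₁} {m₂} {n₁} {n₂} e₁₁ e₁₂ e₂₁ e₂₂ i j with split-view m₁ m₂ i | split-view n₁ n₂ j
  ... | left i  | left j  = e₁₁ i j
  ... | left i  | right j = e₁₂ i j
  ... | right i | left j  = e₂₁ i j
  ... | right i | right j = e₂₂ i j

  block-cong : ∀ {m₁ m₂ n₁ n₂} {A A′ : Matrix m₁ n₁} {B B′ : Matrix m₁ n₂}
    {C C′ : Matrix m₂ n₁} {D D′ : Matrix m₂ n₂} →
    A ≐ A′ → B ≐ B′ → C ≐ C′ → D ≐ D′ → block A B C D ≐ block A′ B′ C′ D′
  block-cong {m₁} {n₁ = n₁} eA eB eC eD i j with splitAt m₁ i | splitAt n₁ j
  ... | inj₁ i′ | inj₁ j′ = eA i′ j′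
  ... | inj₁ i′ | inj₂ j′ = eB i′ j′
  ... | inj₂ i′ | inj₁ j′ = eC i′ j′
  ... | inj₂ i′ | inj₂ j′ = eD i′ j′

  ⊗-split : ∀ {m n₁ n₂ p} (X : Matrix m (n₁ ℕ.+ n₂)) (Y : Matrix (n₁ ℕ.+ n₂) p)
    {P : Matrix m n₁} {Q : Matrix n₁ p} {R : Matrix m n₂} {S : Matrix n₂ p} →
    (∀ i l → X i (l ↑ˡ n₂) ≡ P i l) → (∀ l j → Y (l ↑ˡ n₂) j ≡ Q l j) →
    (∀ i l → X i (n₁ ↑ʳ l) ≡ R i l) → (∀ l j → Y (n₁ ↑ʳ l) j ≡ S l j) →
    (X ⊗ Y) ≐ ((P ⊗ Q) +M (R ⊗ S))
  ⊗-split {n₁ = n₁} {n₂} X Y eP eQ eR eS i j =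
    trans (sumFin-++ n₁ n₂ _)
          (cong₂ _+_ (sumFin-cong n₁ (λ l → cong₂ Data.Integer._*_ (eP i l) (eQ l j)))
                     (sumFin-cong n₂ (λ l → cong₂ Data.Integer._*_ (eR i l) (eS l j))))

  block-⊗ : ∀ {m₁ m₂ n₁ n₂ p₁ p₂}
    (A : Matrix m₁ n₁) (B : Matrix m₁ n₂) (C : Matrix m₂ n₁) (D : Matrix m₂ n₂)
    (A′ : Matrix n₁ p₁) (B′ : Matrix n₁ p₂) (C′ : Matrix n₂ p₁) (D′ : Matrix n₂ p₂) →
    (block A B C D ⊗ block A′ B′ C′ D′) ≐
    block ((A ⊗ A′) +M (B ⊗ C′)) ((A ⊗ B′) +M (B ⊗ D′)) ((C ⊗ A′) +M (D ⊗ C′)) ((C ⊗ B′) +M (D ⊗ D′))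
  block-⊗ {m₁} {m₂} {n₁} {n₂} {p₁} {p₂} A B C D A′ B′ C′ D′ = block-ext
    (λ i j → trans (⊗-split (top M) (left-of M′) (block-₁₁ A B C D) (block-₁₁ A′ B′ C′ D′)
                                                (block-₁₂ A B C D) (block-₂₁ A′ B′ C′ D′) i j)
                   (sym (block-₁₁ N₁₁ N₁₂ N₂₁ N₂₂ i j)))
    (λ i j → trans (⊗-split (top M) (right-of M′) (block-₁₁ A B C D) (block-₁₂ A′ B′ C′ D′)
                                                 (block-₁₂ A B C D) (block-₂₂ A′ B′ C′ D′) i j)
                   (sym (block-₁₂ N₁₁ N₁₂ N₂₁ N₂₂ i j)))
    (λ i j → trans (⊗-split (bottom M) (left-of M′) (block-₂₁ A B C D) (block-₁₁ A′ B′ C′ D′)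
                                                   (block-₂₂ A B C D) (block-₂₁ A′ B′ C′ D′) i j)
                   (sym (block-₂₁ N₁₁ N₁₂ N₂₁ N₂₂ i j)))
    (λ i j → trans (⊗-split (bottom M) (right-of M′) (block-₂₁ A B C D) (block-₁₂ A′ B′ C′ D′)
                                                    (block-₂₂ A B C D) (block-₂₂ A′ B′ C′ D′) i j)
                   (sym (block-₂₂ N₁₁ N₁₂ N₂₁ N₂₂ i j)))
    where
    M = block A B C D
    M′ = block A′ B′ C′ D′
    N₁₁ = (A ⊗ A′) +M (B ⊗ C′)
    N₁₂ = (A ⊗ B′) +M (B ⊗ D′)
    N₂₁ = (C ⊗ A′) +M (D ⊗ C′)
    N₂₂ = (C ⊗ B′) +M (D ⊗ D′)
    top : Matrix (m₁ ℕ.+ m₂) (n₁ ℕ.+ n₂) → Matrix m₁ (n₁ ℕ.+ n₂)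
    top X i = X (i ↑ˡ m₂)
    bottom : Matrix (m₁ ℕ.+ m₂) (n₁ ℕ.+ n₂) → Matrix m₂ (n₁ ℕ.+ n₂)
    bottom X i = X (m₁ ↑ʳ i)
    left-of : Matrix (n₁ ℕ.+ n₂) (p₁ ℕ.+ p₂) → Matrix (n₁ ℕ.+ n₂) p₁
    left-of Y l j = Y l (j ↑ˡ p₂)
    right-of : Matrix (n₁ ℕ.+ n₂) (p₁ ℕ.+ p₂) → Matrix (n₁ ℕ.+ n₂) p₂
    right-of Y l j = Y l (p₁ ↑ʳ j)

  upper-⊗ : ∀ {m₁ m₂ n₁ n₂ p₁ p₂}
    (A : Matrix m₁ n₁) (B : Matrix m₁ n₂) (D : Matrix m₂ n₂)
    (A′ : Matrix n₁ p₁) (B′ : Matrix n₁ p₂) (D′ : Matrix n₂ p₂) →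
    (block A B 0M D ⊗ block A′ B′ 0M D′) ≐ block (A ⊗ A′) ((A ⊗ B′) +M (B ⊗ D′)) 0M (D ⊗ D′)
  upper-⊗ A B D A′ B′ D′ = ≐-trans (block-⊗ A B 0M D A′ B′ 0M D′)
    (block-cong (λ i j → trans (cong ((A ⊗ A′) i j +_) (⊗-zeroʳ B i j)) (ℤ.+-identityʳ _))
                ≐-refl
                (λ i j → cong₂ _+_ (⊗-zeroˡ A′ i j) (⊗-zeroʳ D i j))
                (λ i j → trans (cong (_+ (D ⊗ D′) i j) (⊗-zeroˡ B′ i j)) (ℤ.+-identityˡ _)))

  identity-block : ∀ m₁ m₂ → identity (m₁ ℕ.+ m₂) ≐ block (identity m₁) 0M 0M (identity m₂)
  identity-block m₁ m₂ = block-ext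
    (λ i j → trans (𝟙-≡ᵇ-cong (toℕ-↑ˡ i m₂) (toℕ-↑ˡ j m₂)) (sym (block-₁₁ I₁ 0M 0M I₂ i j)))
    (λ i j → trans (𝟙-≢ (λ e → ℕ.<⇒≢ (below i j) (trans (sym (toℕ-↑ˡ i m₂)) (trans e (toℕ-↑ʳ m₁ j)))))
                   (sym (block-₁₂ I₁ 0M 0M I₂ i j)))
    (λ i j → trans (𝟙-≢ (λ e → ℕ.<⇒≢ (below j i) (trans (sym (toℕ-↑ˡ j m₂)) (trans (sym e) (toℕ-↑ʳ m₁ i)))))
                   (sym (block-₂₁ I₁ 0M 0M I₂ i j)))
    (λ i j → trans (cong 𝟙 (trans (cong₂ _≡ᵇ_ (toℕ-↑ʳ m₁ i) (toℕ-↑ʳ m₁ j)) (≡ᵇ-+ m₁ (toℕ i) (toℕ j))))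
                   (sym (block-₂₂ I₁ 0M 0M I₂ i j)))
    where
    I₁ = identity m₁
    I₂ = identity m₂
    below : (i : Fin m₁) (j : Fin m₂) → toℕ i < m₁ ℕ.+ toℕ j
    below i j = ℕ.<-≤-trans (toℕ<n i) (ℕ.m≤m+n m₁ (toℕ j))

  unimodular-upper : ∀ {m₁ m₂} {A : Matrix m₁ m₁} {D : Matrix m₂ m₂} (B : Matrix m₁ m₂) →
    Unimodular A → Unimodular D → Unimodular (block A B 0M D)
  unimodular-upper {m₁} {m₂} {A} {D} B (A⁻¹ , AA⁻¹ , A⁻¹A) (D⁻¹ , DD⁻¹ , D⁻¹D) =
    block A⁻¹ B′ 0M D⁻¹ ,
    ≐-trans (upper-⊗ A B D A⁻¹ B′ D⁻¹)
            (≐-trans (block-cong AA⁻¹ top-right ≐-refl DD⁻¹) (≐-sym (identity-block m₁ m₂))) ,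
    ≐-trans (upper-⊗ A⁻¹ B′ D⁻¹ A B D)
            (≐-trans (block-cong A⁻¹A bottom-left ≐-refl D⁻¹D) (≐-sym (identity-block m₁ m₂)))
    where
    B′ : Matrix m₁ m₂
    B′ = neg ((A⁻¹ ⊗ B) ⊗ D⁻¹)
    A[A⁻¹B] : (A ⊗ (A⁻¹ ⊗ B)) ≐ B
    A[A⁻¹B] = ≐-trans (≐-sym (⊗-assoc A A⁻¹ B)) (≐-trans (⊗-congʳ B AA⁻¹) (⊗-identityˡ B))
    top-right : ((A ⊗ B′) +M (B ⊗ D⁻¹)) ≐ 0M
    top-right i j = trans (cong (_+ (B ⊗ D⁻¹) i j)
                        (trans (⊗-negʳ A ((A⁻¹ ⊗ B) ⊗ D⁻¹) i j)
                          (cong Data.Integer.-_ (trans (≐-sym (⊗-assoc A (A⁻¹ ⊗ B) D⁻¹) i j)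
                                                       (⊗-congʳ D⁻¹ A[A⁻¹B] i j)))))
                      (ℤ.+-inverseˡ ((B ⊗ D⁻¹) i j))
    bottom-left : ((A⁻¹ ⊗ B) +M (B′ ⊗ D)) ≐ 0M
    bottom-left i j = trans (cong ((A⁻¹ ⊗ B) i j +_)
                       (trans (⊗-negˡ ((A⁻¹ ⊗ B) ⊗ D⁻¹) D i j)
                         (cong Data.Integer.-_ (trans (⊗-assoc (A⁻¹ ⊗ B) D⁻¹ D i j)
                                                      (trans (⊗-congˡ (A⁻¹ ⊗ B) D⁻¹D i j)
                                                             (⊗-identityʳ (A⁻¹ ⊗ B) i j))))))
                     (ℤ.+-inverseʳ ((A⁻¹ ⊗ B) i j))

  unimodular-lower : ∀ {m₁ m₂} (C : Matrix m₂ m₁) → Unimodular (block (identity m₁) 0M C (identity m₂))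
  unimodular-lower {m₁} {m₂} C =
    block I₁ 0M (neg C) I₂ ,
    ≐-trans (block-⊗ I₁ 0M C I₂ I₁ 0M (neg C) I₂)
      (≐-trans (block-cong (diag₁ (neg C)) off (cancel C (neg C) (λ i j → ℤ.+-inverseʳ (C i j))) (diag₂ C))
               (≐-sym (identity-block m₁ m₂))) ,
    ≐-trans (block-⊗ I₁ 0M (neg C) I₂ I₁ 0M C I₂)
      (≐-trans (block-cong (diag₁ C) off (cancel (neg C) C (λ i j → ℤ.+-inverseˡ (C i j))) (diag₂ (neg C)))
               (≐-sym (identity-block m₁ m₂)))
    where
    I₁ = identity m₁
    I₂ = identity m₂
    diag₁ : ∀ (X : Matrix m₂ m₁) → ((I₁ ⊗ I₁) +M (0M ⊗ X)) ≐ I₁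
    diag₁ X i j = trans (cong₂ _+_ (⊗-identityˡ I₁ i j) (⊗-zeroˡ {m = m₁} X i j)) (ℤ.+-identityʳ _)
    off : ((I₁ ⊗ 0M) +M (0M ⊗ I₂)) ≐ 0M
    off i j = cong₂ _+_ (⊗-zeroʳ I₁ i j) (⊗-zeroˡ I₂ i j)
    diag₂ : ∀ (X : Matrix m₂ m₁) → ((X ⊗ 0M) +M (I₂ ⊗ I₂)) ≐ I₂
    diag₂ X i j = trans (cong₂ _+_ (⊗-zeroʳ X i j) (⊗-identityˡ I₂ i j)) (ℤ.+-identityˡ _)
    cancel : ∀ (X Y : Matrix m₂ m₁) → (X +M Y) ≐ 0M → ((X ⊗ I₁) +M (I₂ ⊗ Y)) ≐ 0M
    cancel X Y X+Y≐0 i j = trans (cong₂ _+_ (⊗-identityʳ X i j) (⊗-identityˡ Y i j)) (X+Y≐0 i j)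


module SmithForm where

  open import Data.Nat as ℕ using (ℕ; zero; suc; _≤_; _∸_; _≡ᵇ_; z≤n; s≤s)
  import Data.Nat.Properties as ℕ
  open import Data.Fin as Fin using (Fin; toℕ; _↑ˡ_; _↑ʳ_; inject≤; join)
  open import Data.Fin.Properties using (toℕ-↑ˡ; toℕ-↑ʳ; toℕ<n; toℕ-inject≤; splitAt-↑ˡ; splitAt-↑ʳ; +↔⊎)
  open import Data.Sum as Sum using ()
  open import Data.Sum.Algebra using (⊎-comm)
  open import Function using (_∘′_)
  open import Function.Construct.Composition using (_↔-∘_)
  open import Function.Construct.Symmetry using (↔-sym)
  open import Data.Fin.Permutation
    using (Permutation; Permutation′; _⟨$⟩ʳ_; inverseˡ; inverseʳ; permutation; flip; ↔⇒≡)
  import Data.Fin.Permutation as Permutation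
  open import Data.Integer using (ℤ; 1ℤ; _+_; _-_; -_)
  import Data.Integer.Properties as ℤ
  open import Data.Product using (_×_; _,_)
  open import Relation.Binary.PropositionalEquality
  open NatTests
  open Matrices
  open Blocks

  SNFisIO-cong : ∀ {m n} {A A′ : Matrix m n} → A ≐ A′ → SNFisIO A → SNFisIO A′
  SNFisIO-cong A≐A′ (U , V , U-unimod , V-unimod , UAV≐IO) =
    U , V , U-unimod , V-unimod , ≐-trans (⊗-congʳ V (⊗-congˡ U (≐-sym A≐A′))) UAV≐IO

  SNFisIO-IO : ∀ m n → SNFisIO (IO m n)
  SNFisIO-IO m n = identity m , identity n , unimodular-identity m , unimodular-identity n ,
                   ≐-trans (⊗-identityʳ (identity m ⊗ IO m n)) (⊗-identityˡ (IO m n))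

  SNFisIO-⊗ˡ : ∀ {m n} {P : Matrix m m} {A : Matrix m n} → Unimodular P → SNFisIO (P ⊗ A) → SNFisIO A
  SNFisIO-⊗ˡ {P = P} {A} P-unimod (U , V , U-unimod , V-unimod , UPAV≐IO) =
    U ⊗ P , V , unimodular-⊗ U-unimod P-unimod , V-unimod ,
    ≐-trans (⊗-congʳ V (⊗-assoc U P A)) UPAV≐IO

  SNFisIO-⊗ʳ : ∀ {m n} {Q : Matrix n n} {A : Matrix m n} → Unimodular Q → SNFisIO (A ⊗ Q) → SNFisIO A
  SNFisIO-⊗ʳ {Q = Q} {A} Q-unimod (U , V , U-unimod , V-unimod , UAQV≐IO) =
    U , Q ⊗ V , U-unimod , unimodular-⊗ Q-unimod V-unimod ,
    ≐-trans (≐-sym (⊗-assoc (U ⊗ A) Q V)) (≐-trans (⊗-congʳ V (⊗-assoc U A Q)) UAQV≐IO)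

  SNFisIO-neg : ∀ {m n} {A : Matrix m n} → SNFisIO A → SNFisIO (neg A)
  SNFisIO-neg {A = A} (U , V , U-unimod , V-unimod , UAV≐IO) =
    neg U , V , unimodular-neg U-unimod , V-unimod , ≐-trans (⊗-congʳ V (⊗-neg-neg U A)) UAV≐IO

  columnPermutation : ∀ {n} → Permutation′ n → Matrix n n
  columnPermutation π l j = δ l (π ⟨$⟩ʳ j)

  rowPermutation : ∀ {n} → Permutation′ n → Matrix n n
  rowPermutation π i l = δ (π ⟨$⟩ʳ i) l

  ⊗-columnPermutation : ∀ {m n} (A : Matrix m n) π → (A ⊗ columnPermutation π) ≐ (λ i j → A i (π ⟨$⟩ʳ j))
  ⊗-columnPermutation {n = n} A π i j = sumFin-δʳ n (π ⟨$⟩ʳ j) (A i)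

  rowPermutation-⊗ : ∀ {m n} π (A : Matrix m n) → (rowPermutation π ⊗ A) ≐ (λ i j → A (π ⟨$⟩ʳ i) j)
  rowPermutation-⊗ {m} π A i j = sumFin-δˡ m (π ⟨$⟩ʳ i) (λ l → A l j)

  unimodular-columnPermutation : ∀ {n} (π : Permutation′ n) → Unimodular (columnPermutation π)
  unimodular-columnPermutation π = columnPermutation (flip π) ,
    (λ i j → trans (⊗-columnPermutation (columnPermutation π) (flip π) i j) (cong (δ i) (inverseʳ π))) ,
    (λ i j → trans (⊗-columnPermutation (columnPermutation (flip π)) π i j) (cong (δ i) (inverseˡ π)))

  unimodular-rowPermutation : ∀ {n} (π : Permutation′ n) → Unimodular (rowPermutation π)
  unimodular-rowPermutation π = rowPermutation (flip π) ,
    (λ i j → trans (rowPermutation-⊗ π (rowPermutation (flip π)) i j) (cong (λ k → δ k j) (inverseˡ π))) ,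
    (λ i j → trans (rowPermutation-⊗ (flip π) (rowPermutation π) i j) (cong (λ k → δ k j) (inverseʳ π)))

  SNFisIO-reindex : ∀ {m m′ n n′} (π : Permutation m′ m) (ρ : Permutation n′ n) {A : Matrix m n} →
    SNFisIO A → SNFisIO (λ i j → A (π ⟨$⟩ʳ i) (ρ ⟨$⟩ʳ j))
  SNFisIO-reindex π ρ = reindex (↔⇒≡ π) (↔⇒≡ ρ) π ρ
    where
    reindex : ∀ {m m′ n n′} → m′ ≡ m → n′ ≡ n →
      (π : Permutation m′ m) (ρ : Permutation n′ n) {A : Matrix m n} → SNFisIO A → SNFisIO (λ i j → A (π ⟨$⟩ʳ i) (ρ ⟨$⟩ʳ j))
    reindex refl refl π ρ {A} A-IO =
      SNFisIO-⊗ˡ (unimodular-rowPermutation (flip π))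
        (SNFisIO-⊗ʳ (unimodular-columnPermutation (flip ρ)) (SNFisIO-cong restored A-IO))
      where
      B = λ i j → A (π ⟨$⟩ʳ i) (ρ ⟨$⟩ʳ j)
      restored : A ≐ ((rowPermutation (flip π) ⊗ B) ⊗ columnPermutation (flip ρ))
      restored i j = sym (trans (⊗-columnPermutation (rowPermutation (flip π) ⊗ B) (flip ρ) i j)
                                (trans (rowPermutation-⊗ (flip π) B i (flip ρ ⟨$⟩ʳ j))
                                       (cong₂ A (inverseʳ π) (inverseʳ ρ))))

  IO⊗IOᵀ : ∀ m n → m ≤ n → (IO m n ⊗ IO n m) ≐ identity m
  IO⊗IOᵀ m n m≤n i j =
    trans (sumFin-cong n (λ l → cong (Data.Integer._* IO n m l j) (𝟙-≡ᵇ-cong (sym (toℕ-inject≤ i m≤n)) refl)))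
          (trans (sumFin-δˡ n (inject≤ i m≤n) (λ l → IO n m l j)) (𝟙-≡ᵇ-cong (toℕ-inject≤ i m≤n) refl))

  module _ {m₁ m₂ n₁ n₂ : ℕ} (m₁≤n₁ : m₁ ≤ n₁) (m₂≤n₂ : m₂ ≤ n₂) where

    private
      a = n₁ ∸ m₁

      m₁+a≡n₁ : m₁ ℕ.+ a ≡ n₁
      m₁+a≡n₁ = ℕ.m+[n∸m]≡n m₁≤n₁

      fits : m₁ ℕ.+ (a ℕ.+ m₂) ≤ n₁ ℕ.+ n₂
      fits = subst (ℕ._≤ n₁ ℕ.+ n₂) (trans (cong (ℕ._+ m₂) (sym m₁+a≡n₁)) (ℕ.+-assoc m₁ a m₂))
                   (ℕ.+-monoʳ-≤ n₁ m₂≤n₂)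

    open Interchange m₁ a m₂
    open OnFin fits

    private
      σ-top : ∀ (i : Fin m₁) → σ (toℕ (i ↑ˡ m₂)) ≡ toℕ i
      σ-top i = trans (cong σ (toℕ-↑ˡ i m₂)) (σ-prefix (toℕ i) (toℕ<n i))

      σ-bottom : ∀ (i : Fin m₂) → σ (toℕ (m₁ ↑ʳ i)) ≡ n₁ ℕ.+ toℕ i
      σ-bottom i = trans (cong σ (toℕ-↑ʳ m₁ i))
        (trans (σ-first (toℕ i) (toℕ<n i)) (trans (sym (ℕ.+-assoc m₁ a (toℕ i))) (cong (ℕ._+ toℕ i) m₁+a≡n₁)))

    diagonalIO : Matrix (m₁ ℕ.+ m₂) (n₁ ℕ.+ n₂)
    diagonalIO = block (IO m₁ n₁) 0M 0M (IO m₂ n₂)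

    diagonalIO-entry : ∀ i c → diagonalIO i c ≡ 𝟙 (σ (toℕ i) ≡ᵇ toℕ c)
    diagonalIO-entry i c with split-view m₁ m₂ i | split-view n₁ n₂ c
    ... | left i  | left c  = trans (block-₁₁ (IO m₁ n₁) 0M 0M (IO m₂ n₂) i c)
                                    (𝟙-≡ᵇ-cong (sym (σ-top i)) (sym (toℕ-↑ˡ c n₂)))
    ... | left i  | right c = trans (block-₁₂ (IO m₁ n₁) 0M 0M (IO m₂ n₂) i c) (sym (𝟙-≢ λ e →
                                ℕ.<⇒≢ (ℕ.<-≤-trans (toℕ<n i) (ℕ.≤-trans m₁≤n₁ (ℕ.m≤m+n n₁ (toℕ c))))
                                      (trans (sym (σ-top i)) (trans e (toℕ-↑ʳ n₁ c)))))
    ... | right i | left c  = trans (block-₂₁ (IO m₁ n₁) 0M 0M (IO m₂ n₂) i c) (sym (𝟙-≢ λ e →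
                                ℕ.<⇒≢ (ℕ.<-≤-trans (toℕ<n c) (ℕ.m≤m+n n₁ (toℕ i)))
                                      (trans (sym (toℕ-↑ˡ c n₂)) (trans (sym e) (σ-bottom i)))))
    ... | right i | right c = trans (block-₂₂ (IO m₁ n₁) 0M 0M (IO m₂ n₂) i c)
                                    (trans (cong 𝟙 (sym (≡ᵇ-+ n₁ (toℕ i) (toℕ c))))
                                           (𝟙-≡ᵇ-cong (sym (σ-bottom i)) (sym (toℕ-↑ʳ n₁ c))))

    SNFisIO-diagonalIO : SNFisIO diagonalIO
    SNFisIO-diagonalIO =
      SNFisIO-cong (λ i j → trans (sym (permuted-entry i (τᶠ j))) (cong (diagonalIO i) (σᶠ∘τᶠ j)))
        (SNFisIO-reindex Permutation.id (permutation τᶠ σᶠ τᶠ∘σᶠ σᶠ∘τᶠ) (SNFisIO-IO _ _))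
      where
      permuted-entry : ∀ i j → diagonalIO i (σᶠ j) ≡ IO _ _ i j
      permuted-entry i j = trans (diagonalIO-entry i (σᶠ j))
        (cong 𝟙 (trans (cong (σ (toℕ i) ≡ᵇ_) (toℕ-σᶠ j)) (≡ᵇ-injective σ σ-injective (toℕ i) (toℕ j))))

  SNFisIO-clearCorner : ∀ {m₁ m₂ n₁ n₂} {D : Matrix m₂ n₂} (B : Matrix m₁ n₂) → m₁ ≤ n₁ →
    SNFisIO (block (IO m₁ n₁) 0M 0M D) → SNFisIO (block (IO m₁ n₁) B 0M D)
  SNFisIO-clearCorner {m₁} {m₂} {n₁} {n₂} {D} B m₁≤n₁ =
    SNFisIO-⊗ʳ (unimodular-upper E (unimodular-identity n₁) (unimodular-identity n₂)) ∘′
    SNFisIO-cong (≐-sym cleared)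
    where
    E : Matrix n₁ n₂
    E = neg (IO n₁ m₁ ⊗ B)
    cleared : (block (IO m₁ n₁) B 0M D ⊗ block (identity n₁) E 0M (identity n₂)) ≐ block (IO m₁ n₁) 0M 0M D
    cleared = ≐-trans (upper-⊗ (IO m₁ n₁) B D (identity n₁) E (identity n₂))
      (block-cong (⊗-identityʳ (IO m₁ n₁)) corner ≐-refl (⊗-identityʳ D))
      where
      corner : ((IO m₁ n₁ ⊗ E) +M (B ⊗ identity n₂)) ≐ 0M
      corner i j = trans (cong₂ _+_ (trans (⊗-negʳ (IO m₁ n₁) (IO n₁ m₁ ⊗ B) i j)
                                    (cong -_ (trans (≐-sym (⊗-assoc (IO m₁ n₁) (IO n₁ m₁) B) i j)
                                                    (trans (⊗-congʳ B (IO⊗IOᵀ m₁ n₁ m₁≤n₁) i j)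
                                                           (⊗-identityˡ B i j)))))
                                    (⊗-identityʳ B i j))
                         (ℤ.+-inverseˡ (B i j))

  -- The row bound m ≤ n is carried along because straightening block-diagonal (I | O)'s needs it.
  WideIO : ∀ {m n} → Matrix m n → Set
  WideIO {m} {n} A = m ≤ n × SNFisIO A

  WideIO-cong : ∀ {m n} {A A′ : Matrix m n} → A ≐ A′ → WideIO A → WideIO A′
  WideIO-cong A≐A′ (m≤n , A-IO) = m≤n , SNFisIO-cong A≐A′ A-IO

  WideIO-upper : ∀ {m₁ m₂ n₁ n₂} {A : Matrix m₁ n₁} {D : Matrix m₂ n₂} (B : Matrix m₁ n₂) →
    WideIO A → WideIO D → WideIO (block A B 0M D)
  WideIO-upper {m₁} {m₂} {n₁} {n₂} {A} {D} B
    (m₁≤n₁ , U₁ , V₁ , U₁-unimod , V₁-unimod , U₁AV₁≐IO)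
    (m₂≤n₂ , U₂ , V₂ , U₂-unimod , V₂-unimod , U₂DV₂≐IO) =
    ℕ.+-mono-≤ m₁≤n₁ m₂≤n₂ ,
    SNFisIO-⊗ˡ (unimodular-upper 0M U₁-unimod U₂-unimod)
      (SNFisIO-⊗ʳ (unimodular-upper 0M V₁-unimod V₂-unimod)
        (SNFisIO-cong (≐-sym reduced)
          (SNFisIO-clearCorner ((U₁ ⊗ B) ⊗ V₂) m₁≤n₁ (SNFisIO-diagonalIO m₁≤n₁ m₂≤n₂))))
    where
    U = block U₁ 0M 0M U₂
    V = block V₁ 0M 0M V₂
    UM : (U ⊗ block A B 0M D) ≐ block (U₁ ⊗ A) (U₁ ⊗ B) 0M (U₂ ⊗ D)
    UM = ≐-trans (upper-⊗ U₁ 0M U₂ A B D)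
                 (block-cong ≐-refl (λ i j → trans (cong ((U₁ ⊗ B) i j +_) (⊗-zeroˡ D i j)) (ℤ.+-identityʳ _))
                             ≐-refl ≐-refl)
    UMV : (block (U₁ ⊗ A) (U₁ ⊗ B) 0M (U₂ ⊗ D) ⊗ V) ≐ block (IO m₁ n₁) ((U₁ ⊗ B) ⊗ V₂) 0M (IO m₂ n₂)
    UMV = ≐-trans (upper-⊗ (U₁ ⊗ A) (U₁ ⊗ B) (U₂ ⊗ D) V₁ 0M V₂)
                  (block-cong U₁AV₁≐IO
                              (λ i j → trans (cong (_+ ((U₁ ⊗ B) ⊗ V₂) i j) (⊗-zeroʳ (U₁ ⊗ A) i j)) (ℤ.+-identityˡ _))
                              ≐-refl U₂DV₂≐IO)
    reduced : ((U ⊗ block A B 0M D) ⊗ V) ≐ block (IO m₁ n₁) ((U₁ ⊗ B) ⊗ V₂) 0M (IO m₂ n₂)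
    reduced = ≐-trans (⊗-congʳ V UM) UMV

  WideIO-reindex : ∀ {m m′ n n′} (π : Permutation m′ m) (ρ : Permutation n′ n) {A : Matrix m n} →
    WideIO A → WideIO (λ i j → A (π ⟨$⟩ʳ i) (ρ ⟨$⟩ʳ j))
  WideIO-reindex π ρ (m≤n , A-IO) = subst₂ _≤_ (sym (↔⇒≡ π)) (sym (↔⇒≡ ρ)) m≤n , SNFisIO-reindex π ρ A-IO

  WideIO-neg : ∀ {m n} {A : Matrix m n} → WideIO A → WideIO (neg A)
  WideIO-neg (m≤n , A-IO) = m≤n , SNFisIO-neg A-IO

  WideIO-antidiagonal : ∀ {m₁ m₂ n₁ n₂} (A : Matrix m₁ n₁) {B : Matrix m₁ n₂} {C : Matrix m₂ n₁} →
    WideIO B → WideIO C → WideIO (block A B C 0M)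
  WideIO-antidiagonal {m₁} {m₂} {n₁} {n₂} A {B} {C} B-IO C-IO =
    WideIO-cong swapped (WideIO-reindex Permutation.id swapBlocks (WideIO-upper A B-IO C-IO))
    where
    swapBlocks : Permutation (n₁ ℕ.+ n₂) (n₂ ℕ.+ n₁)
    swapBlocks = ↔-sym (+↔⊎ {n₂} {n₁}) ↔-∘ (⊎-comm (Fin n₁) (Fin n₂) ↔-∘ +↔⊎ {n₁} {n₂})
    swap-↑ˡ : ∀ j → swapBlocks ⟨$⟩ʳ (j ↑ˡ n₂) ≡ n₂ ↑ʳ j
    swap-↑ˡ j = cong (λ s → join n₂ n₁ (Sum.swap s)) (splitAt-↑ˡ n₁ j n₂)
    swap-↑ʳ : ∀ j → swapBlocks ⟨$⟩ʳ (n₁ ↑ʳ j) ≡ j ↑ˡ n₁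
    swap-↑ʳ j = cong (λ s → join n₂ n₁ (Sum.swap s)) (splitAt-↑ʳ n₁ n₂ j)
    M = block B A 0M C
    N = block A B C 0M
    swapped : (λ i j → M i (swapBlocks ⟨$⟩ʳ j)) ≐ N
    swapped = block-ext
      (λ i j → trans (cong (M (i ↑ˡ m₂)) (swap-↑ˡ j)) (trans (block-₁₂ B A 0M C i j) (sym (block-₁₁ A B C 0M i j))))
      (λ i j → trans (cong (M (i ↑ˡ m₂)) (swap-↑ʳ j)) (trans (block-₁₁ B A 0M C i j) (sym (block-₁₂ A B C 0M i j))))
      (λ i j → trans (cong (M (m₁ ↑ʳ i)) (swap-↑ˡ j)) (trans (block-₂₂ B A 0M C i j) (sym (block-₂₁ A B C 0M i j))))
      (λ i j → trans (cong (M (m₁ ↑ʳ i)) (swap-↑ʳ j)) (trans (block-₂₁ B A 0M C i j) (sym (block-₂₂ A B C 0M i j))))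

  WideIO-ones : ∀ {n} → 1 ≤ n → WideIO (λ (_ : Fin 1) (_ : Fin n) → 1ℤ)
  WideIO-ones {suc n} _ =
    WideIO-cong ones (WideIO-upper {A = IO 1 1} {D = IO 0 n} (λ _ _ → 1ℤ) (s≤s z≤n , SNFisIO-IO 1 1) (z≤n , SNFisIO-IO 0 n))
    where
    ones : block (IO 1 1) (λ _ _ → 1ℤ) 0M (IO 0 n) ≐ (λ _ _ → 1ℤ)
    ones Fin.zero Fin.zero    = refl
    ones Fin.zero (Fin.suc j) = refl

  WideIO-rowReduce : ∀ {m₁ m₂ n₁ n₂} (π : Fin m₂ → Fin m₁)
    {A : Matrix m₁ n₁} {B : Matrix m₁ n₂} {C : Matrix m₂ n₁} {D : Matrix m₂ n₂} →
    WideIO (block A B (λ i j → C i j - A (π i) j) (λ i j → D i j - B (π i) j)) → WideIO (block A B C D)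
  WideIO-rowReduce {m₁} {m₂} π {A} {B} {C} {D} (m≤n , reduced-IO) =
    m≤n , SNFisIO-⊗ˡ (unimodular-lower (neg P)) (SNFisIO-cong (≐-sym reduce) reduced-IO)
    where
    P : Matrix m₂ m₁
    P i l = δ (π i) l
    -P⊗ : ∀ {n} (X : Matrix m₁ n) → (neg P ⊗ X) ≐ (λ i j → - X (π i) j)
    -P⊗ X i j = trans (⊗-negˡ P X i j) (cong -_ (sumFin-δˡ m₁ (π i) (λ l → X l j)))
    subtract : ∀ {n} (X : Matrix m₁ n) (Y : Matrix m₂ n) →
      ((neg P ⊗ X) +M (identity m₂ ⊗ Y)) ≐ (λ i j → Y i j - X (π i) j)
    subtract X Y i j = trans (cong₂ _+_ (-P⊗ X i j) (⊗-identityˡ Y i j)) (ℤ.+-comm _ (Y i j))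
    keep : ∀ {n} (X : Matrix m₁ n) (Y : Matrix m₂ n) → ((identity m₁ ⊗ X) +M (0M ⊗ Y)) ≐ X
    keep X Y i j = trans (cong₂ _+_ (⊗-identityˡ X i j) (⊗-zeroˡ Y i j)) (ℤ.+-identityʳ _)
    reduce : (block (identity m₁) 0M (neg P) (identity m₂) ⊗ block A B C D) ≐
             block A B (λ i j → C i j - A (π i) j) (λ i j → D i j - B (π i) j)
    reduce = ≐-trans (block-⊗ (identity m₁) 0M (neg P) (identity m₂) A B C D)
                     (block-cong (keep A C) (keep B D) (subtract A C) (subtract B D))


module Bar where

  open import Data.Nat as ℕ using (zero; suc; _+_; _∸_; _≡ᵇ_; _<ᵇ_; _≤_; _<_; z≤n; s≤s; pred)
  import Data.Nat.Properties as ℕ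
  open import Data.Nat.Tactic.RingSolver using (solve-∀)
  open import Data.Bool using (Bool; true; false; if_then_else_; not; _∨_; _∧_)
  import Data.Bool.Properties as Bool
  open import Data.List using (List; []; _∷_; _++_; map; length; head)
  import Data.List.Properties as List
  open import Data.List.Relation.Unary.All using (All; []; _∷_)
  open import Data.Maybe using (Maybe; just; nothing; maybe; is-just)
  open import Data.Unit using (⊤; tt)
  open import Data.Product using (Σ; _×_; _,_; proj₁; proj₂)
  open import Data.Sum using (_⊎_; inj₁; inj₂)
  open import Data.Empty using (⊥-elim)
  open import Function using (_∘_)
  open import Relation.Binary.PropositionalEquality
  open import Relation.Nullary using (Dec; yes; no)
  open NatTests

  mem-++ : ∀ y (xs ys : List ℕ) → mem y (xs ++ ys) ≡ mem y xs ∨ mem y ys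
  mem-++ y []       ys = refl
  mem-++ y (x ∷ xs) ys rewrite mem-++ y xs ys = sym (Bool.∨-assoc (y ≡ᵇ x) (mem y xs) (mem y ys))

  data Increasing : ℕ → List ℕ → Set where
    []   : ∀ {p} → Increasing p []
    cons : ∀ {p a as} → p < a → Increasing a as → Increasing p (a ∷ as)

  Increasing-weaken : ∀ {p q xs} → q ≤ p → Increasing p xs → Increasing q xs
  Increasing-weaken q≤p []             = []
  Increasing-weaken q≤p (cons p<a as↑) = cons (ℕ.≤-<-trans q≤p p<a) as↑

  Increasing-mem-≤ : ∀ {p xs y} → Increasing p xs → y ≤ p → mem y xs ≡ false
  Increasing-mem-≤ []                           y≤p = refl
  Increasing-mem-≤ {y = y} (cons {a = a} p<a as↑) y≤p
    rewrite ≢⇒≡ᵇ≡false {y} {a} (ℕ.<⇒≢ (ℕ.≤-<-trans y≤p p<a)) =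
    Increasing-mem-≤ as↑ (ℕ.≤-trans y≤p (ℕ.<⇒≤ p<a))

  Increasing-removeAt : ∀ {p} j F → Increasing p F → Increasing p (removeAt j F)
  Increasing-removeAt j       []       []             = []
  Increasing-removeAt zero    (a ∷ as) (cons p<a as↑) = Increasing-weaken (ℕ.<⇒≤ p<a) as↑
  Increasing-removeAt (suc j) (a ∷ as) (cons p<a as↑) = cons p<a (Increasing-removeAt j as as↑)

  Increasing-++⁻ˡ : ∀ {p} xs ys → Increasing p (xs ++ ys) → Increasing p xs
  Increasing-++⁻ˡ []       ys _              = []
  Increasing-++⁻ˡ (x ∷ xs) ys (cons p<x xs↑) = cons p<x (Increasing-++⁻ˡ xs ys xs↑)

  data Increasing≤ (n : ℕ) : ℕ → List ℕ → Set where
    []   : ∀ {p} → Increasing≤ n p []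
    cons : ∀ {p a as} → p < a → a ≤ n → Increasing≤ n a as → Increasing≤ n p (a ∷ as)

  Increasing≤⇒Increasing : ∀ {n p xs} → Increasing≤ n p xs → Increasing p xs
  Increasing≤⇒Increasing []                 = []
  Increasing≤⇒Increasing (cons p<a _ as↑)   = cons p<a (Increasing≤⇒Increasing as↑)

  Increasing≤-∷ʳ : ∀ {n p xs} → Increasing≤ n p xs → p < suc n → Increasing≤ (suc n) p (xs ++ (suc n ∷ []))
  Increasing≤-∷ʳ []                 p<1+n = cons p<1+n ℕ.≤-refl []
  Increasing≤-∷ʳ (cons p<a a≤n as↑) _     = cons p<a (ℕ.m≤n⇒m≤1+n a≤n) (Increasing≤-∷ʳ as↑ (s≤s a≤n))

  Increasing≤-weaken : ∀ {n m p xs} → n ≤ m → Increasing≤ n p xs → Increasing≤ m p xs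
  Increasing≤-weaken n≤m []                 = []
  Increasing≤-weaken n≤m (cons p<a a≤n as↑) = cons p<a (ℕ.≤-trans a≤n n≤m) (Increasing≤-weaken n≤m as↑)

  Increasing≤-mem-> : ∀ {n p xs y} → Increasing≤ n p xs → n < y → mem y xs ≡ false
  Increasing≤-mem-> []                             n<y = refl
  Increasing≤-mem-> {y = y} (cons {a = a} _ a≤n as↑) n<y
    rewrite ≢⇒≡ᵇ≡false {y} {a} (λ e → ℕ.<⇒≢ (ℕ.≤-<-trans a≤n n<y) (sym e)) = Increasing≤-mem-> as↑ n<y

  -- Used for the numbers below the current element that are still free to become a b, largest first.
  Decreasing : ℕ → List ℕ → Set
  Decreasing n []       = ⊤
  Decreasing n (x ∷ xs) = 1 ≤ x × x ≤ n × Decreasing (pred x) xs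

  Decreasing-weaken : ∀ {n m} L → n ≤ m → Decreasing n L → Decreasing m L
  Decreasing-weaken []      n≤m _                 = tt
  Decreasing-weaken (x ∷ _) n≤m (1≤x , x≤n , xs↓) = 1≤x , ℕ.≤-trans x≤n n≤m , xs↓

  Decreasing-mem-> : ∀ {n y} L → Decreasing n L → n < y → mem y L ≡ false
  Decreasing-mem-> []               _               n<y = refl
  Decreasing-mem-> {n} {y} (x ∷ xs) (_ , x≤n , xs↓) n<y
    rewrite ≢⇒≡ᵇ≡false {y} {x} (λ e → ℕ.<⇒≢ (ℕ.≤-<-trans x≤n n<y) (sym e)) =
    Decreasing-mem-> xs xs↓ (ℕ.≤-<-trans (ℕ.≤-trans (ℕ.pred-mono-≤ x≤n) (ℕ.pred[n]≤n {n})) n<y)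

  maxAvail≡head : ∀ n ex L → Decreasing n L → (∀ y → 1 ≤ y → y ≤ n → ex y ≡ not (mem y L)) →
    maxAvail n ex ≡ head L
  maxAvail≡head zero    ex []      _                 _ = refl
  maxAvail≡head zero    ex (x ∷ L) (1≤x , x≤0 , _)   _ = ⊥-elim (ℕ.<⇒≱ 1≤x x≤0)
  maxAvail≡head (suc m) ex []      _                 ex≡ rewrite ex≡ (suc m) (s≤s z≤n) ℕ.≤-refl =
    maxAvail≡head m ex [] tt (λ y 1≤y y≤m → ex≡ y 1≤y (ℕ.m≤n⇒m≤1+n y≤m))
  maxAvail≡head (suc m) ex (x ∷ L) (1≤x , x≤1+m , L↓) ex≡ with x ℕ.≟ suc m
  ... | yes refl rewrite ex≡ (suc m) (s≤s z≤n) ℕ.≤-refl | ≡ᵇ-refl m = refl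
  ... | no  x≢   rewrite ex≡ (suc m) (s≤s z≤n) ℕ.≤-refl | ≢⇒≡ᵇ≡false {suc m} {x} (λ e → x≢ (sym e))
                       | Decreasing-mem-> {pred x} {suc m} L L↓ (s≤s (ℕ.pred-mono-≤ x≤1+m)) =
    maxAvail≡head m ex (x ∷ L) (1≤x , ℕ.≤-pred (ℕ.≤∧≢⇒< x≤1+m x≢) , L↓)
                  (λ y 1≤y y≤m → ex≡ y 1≤y (ℕ.m≤n⇒m≤1+n y≤m))

  gap : ℕ → ℕ → List ℕ
  gap p zero    = []
  gap p (suc a) = if p <ᵇ a then a ∷ gap p a else []

  length-gap : ∀ p a → length (gap p a) ≡ a ∸ suc p
  length-gap p zero = refl
  length-gap p (suc a) with p <ᵇ a in eq
  ... | true  = trans (cong suc (length-gap p a)) (sym (ℕ.+-∸-assoc 1 (<ᵇ≡true⇒< p a eq)))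
  ... | false = sym (ℕ.m≤n⇒m∸n≡0 {a} {p} (ℕ.≮⇒≥ (<ᵇ≡false⇒≮ p a eq)))

  mem-gap : ∀ p a y → mem y (gap p a) ≡ (p <ᵇ y) ∧ (y <ᵇ a)
  mem-gap p zero y = sym (Bool.∧-zeroʳ (p <ᵇ y))
  mem-gap p (suc a) y with p <ᵇ a in eq
  ... | true rewrite mem-gap p a y = step (y ℕ.≟ a)
    where
    step : Dec (y ≡ a) → (y ≡ᵇ a) ∨ ((p <ᵇ y) ∧ (y <ᵇ a)) ≡ (p <ᵇ y) ∧ (y <ᵇ suc a)
    step (yes refl) rewrite ≡ᵇ-refl y | <⇒<ᵇ≡true (ℕ.n<1+n y) | eq = refl
    step (no y≢a) rewrite ≢⇒≡ᵇ≡false y≢a with y <ᵇ a in y<ᵇa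
    ... | true  rewrite <⇒<ᵇ≡true (ℕ.m<n⇒m<1+n (<ᵇ≡true⇒< y a y<ᵇa)) = refl
    ... | false rewrite ≮⇒<ᵇ≡false {y} {suc a} (λ y<1+a →
                          y≢a (ℕ.≤-antisym (ℕ.≤-pred y<1+a) (ℕ.≮⇒≥ (<ᵇ≡false⇒≮ y a y<ᵇa)))) = refl
  ... | false with p <ᵇ y in p<ᵇy
  ...   | false = refl
  ...   | true rewrite ≮⇒<ᵇ≡false {y} {suc a} (λ y<1+a →
                         <ᵇ≡false⇒≮ p a eq (ℕ.<-≤-trans (<ᵇ≡true⇒< p y p<ᵇy) (ℕ.≤-pred y<1+a))) = refl

  gap-Decreasing : ∀ p a S → p ≤ a → Decreasing p S → Decreasing a (gap p (suc a) ++ S)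
  gap-Decreasing p zero    S p≤a S↓ = Decreasing-weaken S p≤a S↓
  gap-Decreasing p (suc a) S p≤a S↓ with p <ᵇ suc a in eq
  ... | true  = s≤s z≤n , ℕ.≤-refl , gap-Decreasing p a S (ℕ.≤-pred (<ᵇ≡true⇒< p (suc a) eq)) S↓
  ... | false = Decreasing-weaken S p≤a S↓

  -- flags p c F: for each element a of F (previous element p, c free numbers
  -- below p), the a ∸ suc p numbers strictly between p and a become free, and
  -- the flag records whether a free number is left for b (true) or b = 𝔧 (false).
  mutual
    flags : ℕ → ℕ → List ℕ → List Bool
    flags p c []       = []
    flags p c (a ∷ as) = flags-step a as ((a ∸ suc p) + c)

    flags-step : ℕ → List ℕ → ℕ → List Bool
    flags-step a as zero    = false ∷ flags a 0 as
    flags-step a as (suc c) = true ∷ flags a c as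

  FreeList : List ℕ → ℕ → List ℕ → List ℕ → Set
  FreeList F p used S =
    (∀ y → 1 ≤ y → y ≤ p → (mem y F ∨ mem y used) ≡ not (mem y S)) ×
    (∀ y → p < y → mem y used ≡ false) ×
    Decreasing p S

  Remaining : List ℕ → ℕ → List ℕ → Set
  Remaining F p rest = Increasing p rest × (∀ y → p < y → mem y F ≡ mem y rest)

  bseqGo≡flags : ∀ F rest p used S → Remaining F p rest → FreeList F p used S →
    map is-just (bseqGo F used rest) ≡ flags p (length S) rest
  bseqGo≡flags F []         p used S _                     _                    = refl
  bseqGo≡flags F (a ∷ rest) p used S (cons p<a rest↑ , F≡) (free , unused , S↓) =
    with-free (gap p a ++ S) refl
    where
    taken : ℕ → Bool
    taken y = mem y F ∨ mem y used
    S′ = gap p a ++ S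
    a≡ : suc (pred a) ≡ a
    a≡ = ℕ.suc-pred a {{ℕ.>-nonZero (ℕ.≤-<-trans z≤n p<a)}}
    S′↓ : Decreasing (pred a) S′
    S′↓ = subst (λ z → Decreasing (pred a) (gap p z ++ S)) a≡
            (gap-Decreasing p (pred a) S (ℕ.≤-pred (subst (p <_) (sym a≡) p<a)) S↓)
    S′-free : ∀ y → 1 ≤ y → y ≤ a → taken y ≡ not (mem y S′)
    S′-free y 1≤y y≤a rewrite mem-++ y (gap p a) S | mem-gap p a y with y ℕ.≤? p
    ... | yes y≤p rewrite ≮⇒<ᵇ≡false {p} {y} (ℕ.≤⇒≯ y≤p) = free y 1≤y y≤p
    ... | no  y≰p with y ℕ.≟ a
    ...   | yes refl rewrite <⇒<ᵇ≡true (ℕ.≰⇒> y≰p) | ≮⇒<ᵇ≡false (ℕ.n≮n y) | F≡ y (ℕ.≰⇒> y≰p)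
                           | ≡ᵇ-refl y | Decreasing-mem-> {p} {y} S S↓ (ℕ.≰⇒> y≰p) = refl
    ...   | no  y≢a rewrite <⇒<ᵇ≡true (ℕ.≰⇒> y≰p) | <⇒<ᵇ≡true (ℕ.≤∧≢⇒< y≤a y≢a)
                          | F≡ y (ℕ.≰⇒> y≰p) | ≢⇒≡ᵇ≡false y≢a | Increasing-mem-≤ rest↑ y≤a
                          | unused y (ℕ.≰⇒> y≰p) = refl
    b≡ : maxAvail a taken ≡ head S′
    b≡ = maxAvail≡head a taken S′ (Decreasing-weaken S′ (ℕ.pred[n]≤n {a}) S′↓) S′-free
    length-S′ : (a ∸ suc p) + length S ≡ length S′
    length-S′ = trans (cong (_+ length S) (sym (length-gap p a))) (sym (List.length-++ (gap p a)))
    rest-remaining : Remaining F a rest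
    rest-remaining = rest↑ , λ y a<y →
      trans (F≡ y (ℕ.<-trans p<a a<y)) (cong (_∨ mem y rest) (≢⇒≡ᵇ≡false (λ e → ℕ.<⇒≢ a<y (sym e))))
    unused′ : ∀ y → a < y → mem y used ≡ false
    unused′ y a<y = unused y (ℕ.<-trans p<a a<y)
    with-free : (L : List ℕ) → S′ ≡ L → map is-just (bseqGo F used (a ∷ rest)) ≡ flags p (length S) (a ∷ rest)
    with-free [] S′≡ rewrite b≡ | S′≡ | length-S′ | S′≡ =
      cong (false ∷_) (bseqGo≡flags F rest a used [] rest-remaining
                        ((λ y 1≤y y≤a → trans (S′-free y 1≤y y≤a) (cong (not ∘ mem y) S′≡)) , unused′ , tt))
    with-free (b ∷ S″) S′≡ rewrite b≡ | S′≡ | length-S′ | S′≡ =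
      cong (true ∷_) (bseqGo≡flags F rest a (b ∷ used) S″ rest-remaining (free′ , unused″ , S″↓))
      where
      b∷S″↓ : Decreasing (pred a) (b ∷ S″)
      b∷S″↓ = subst (Decreasing (pred a)) S′≡ S′↓
      b≤a : b ≤ a
      b≤a = ℕ.≤-trans (proj₁ (proj₂ b∷S″↓)) (ℕ.pred[n]≤n {a})
      pred<self : ∀ {y} → 1 ≤ y → pred y < y
      pred<self {suc y} _ = ℕ.n<1+n y
      free′ : ∀ y → 1 ≤ y → y ≤ a → (mem y F ∨ ((y ≡ᵇ b) ∨ mem y used)) ≡ not (mem y S″)
      free′ y 1≤y y≤a with y ℕ.≟ b
      ... | yes refl rewrite ≡ᵇ-refl y
                           | Decreasing-mem-> {pred y} {y} S″ (proj₂ (proj₂ b∷S″↓)) (pred<self 1≤y) =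
        Bool.∨-zeroʳ (mem y F)
      ... | no  y≢b rewrite ≢⇒≡ᵇ≡false y≢b =
        trans (S′-free y 1≤y y≤a) (cong not (trans (cong (mem y) S′≡) (cong (_∨ mem y S″) (≢⇒≡ᵇ≡false y≢b))))
      unused″ : ∀ y → a < y → ((y ≡ᵇ b) ∨ mem y used) ≡ false
      unused″ y a<y rewrite ≢⇒≡ᵇ≡false {y} {b} (λ e → ℕ.<⇒≢ (ℕ.≤-<-trans b≤a a<y) (sym e)) = unused′ y a<y
      S″↓ : Decreasing a S″
      S″↓ = Decreasing-weaken S″ (ℕ.≤-trans (ℕ.pred[n]≤n {b}) b≤a) (proj₂ (proj₂ b∷S″↓))

  flags₀ : List ℕ → List Bool
  flags₀ F = flags 0 0 F

  bseq≡flags : ∀ F → Increasing 0 F → map is-just (bseq F) ≡ flags₀ F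
  bseq≡flags F F↑ =
    bseqGo≡flags F F 0 [] [] (F↑ , λ _ _ → refl) ((λ y 1≤y y≤0 → ⊥-elim (ℕ.<⇒≱ 1≤y y≤0)) , (λ _ _ → refl) , tt)

  length-flags : ∀ p c F → length (flags p c F) ≡ length F
  length-flags p c []       = refl
  length-flags p c (a ∷ as) with (a ∸ suc p) + c
  ... | zero  = cong suc (length-flags a 0 as)
  ... | suc k = cong suc (length-flags a k as)

  flags-rebase : ∀ p q c as → p ≤ q → Increasing q as → flags p c as ≡ flags q (c + (q ∸ p)) as
  flags-rebase p q c []       p≤q _              = refl
  flags-rebase p q c (b ∷ as) p≤q (cons q<b as↑) = cong (flags-step b as) count≡
    where
    gaps : ∀ p q b → p ≤ q → q < b → (b ∸ suc q) + (q ∸ p) ≡ b ∸ suc p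
    gaps zero    q       (suc b) z≤n       (s≤s q≤b) = ℕ.m∸n+n≡m q≤b
    gaps (suc p) (suc q) (suc b) (s≤s p≤q) (s≤s q<b) = gaps p q b p≤q q<b
    count≡ : (b ∸ suc p) + c ≡ (b ∸ suc q) + (c + (q ∸ p))
    count≡ = trans (cong (_+ c) (sym (gaps p q b p≤q q<b)))
                   (trans (ℕ.+-assoc (b ∸ suc q) (q ∸ p) c) (cong ((b ∸ suc q) +_) (ℕ.+-comm (q ∸ p) c)))

  AllTrue : List Bool → Set
  AllTrue = All (_≡ true)

  -- Once every flag is true, the counts stay positive, so extra free numbers change nothing.
  flags-+-AllTrue : ∀ q d e as → AllTrue (flags q d as) → flags q (d + e) as ≡ flags q d as
  flags-+-AllTrue q d e []       _ = refl
  flags-+-AllTrue q d e (b ∷ as) h with (b ∸ suc q) + d in eq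
  flags-+-AllTrue q d e (b ∷ as) (() ∷ _) | zero
  ... | suc k rewrite sym (ℕ.+-assoc (b ∸ suc q) d e) | eq with h
  ...   | _ ∷ h′ = cong (true ∷_) (flags-+-AllTrue b k e as h′)

  lastFalse : List Bool → Maybe ℕ
  lastFalse []       = nothing
  lastFalse (b ∷ bs) with lastFalse bs
  ... | just j  = just (suc j)
  ... | nothing = if b then nothing else just 0

  lastNothing≡lastFalse : ∀ i acc bs →
    lastNothing i acc bs ≡ maybe (λ j → just (i + j)) acc (lastFalse (map is-just bs))
  lastNothing≡lastFalse i acc [] = refl
  lastNothing≡lastFalse i acc (b ∷ bs)
    with lastFalse (map is-just bs) | lastNothing≡lastFalse (suc i) acc bs | lastNothing≡lastFalse (suc i) (just i) bs
  ... | just j  | e | e′ with b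
  ...   | nothing = trans e′ (cong just (sym (ℕ.+-suc i j)))
  ...   | just _  = trans e (cong just (sym (ℕ.+-suc i j)))
  lastNothing≡lastFalse i acc (nothing ∷ bs) | nothing | _ | e′ = trans e′ (cong just (sym (ℕ.+-identityʳ i)))
  lastNothing≡lastFalse i acc (just _ ∷ bs)  | nothing | e | _  = e

  lastFalse-nothing⇒AllTrue : ∀ bs → lastFalse bs ≡ nothing → AllTrue bs
  lastFalse-nothing⇒AllTrue []       _ = []
  lastFalse-nothing⇒AllTrue (b ∷ bs) e with lastFalse bs in eq
  lastFalse-nothing⇒AllTrue (true ∷ bs)  _  | nothing = refl ∷ lastFalse-nothing⇒AllTrue bs eq
  lastFalse-nothing⇒AllTrue (false ∷ bs) () | nothing

  AllTrue⇒lastFalse-nothing : ∀ bs → AllTrue bs → lastFalse bs ≡ nothing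
  AllTrue⇒lastFalse-nothing []          _          = refl
  AllTrue⇒lastFalse-nothing (true ∷ bs) (refl ∷ h) rewrite AllTrue⇒lastFalse-nothing bs h = refl

  lastFalse<length : ∀ bs j → lastFalse bs ≡ just j → j < length bs
  lastFalse<length (b ∷ bs) j e with lastFalse bs in eq
  lastFalse<length (b ∷ bs)     .(suc j) refl | just j  = s≤s (lastFalse<length bs j eq)
  lastFalse<length (true ∷ bs)  j        ()   | nothing
  lastFalse<length (false ∷ bs) .0       refl | nothing = s≤s z≤n

  dropFlag : ℕ → List Bool → List Bool
  dropFlag i       []       = []
  dropFlag zero    (x ∷ xs) = xs
  dropFlag (suc i) (x ∷ xs) = x ∷ dropFlag i xs

  -- Deleting the element with the last 𝔧 only frees one more number for the later
  -- elements, whose flags are all true and hence unaffected (flags-+-AllTrue).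
  LastFalseRemovable : ℕ → ℕ → List ℕ → Set
  LastFalseRemovable p c F = lastFalse (flags p c F) ≡ nothing ⊎
    Σ ℕ λ j → lastFalse (flags p c F) ≡ just j × flags p c (removeAt j F) ≡ dropFlag j (flags p c F)

  lastFalse-removable : ∀ p c F → Increasing p F → LastFalseRemovable p c F
  lastFalse-removable p c []       _              = inj₁ refl
  lastFalse-removable p c (a ∷ as) (cons p<a as↑) with (a ∸ suc p) + c in eq
  ... | zero  = after-𝔧 (lastFalse-removable a 0 as as↑)
    where
    after-𝔧 : LastFalseRemovable a 0 as → lastFalse (false ∷ flags a 0 as) ≡ nothing ⊎
      Σ ℕ λ j → lastFalse (false ∷ flags a 0 as) ≡ just j ×
                flags p c (removeAt j (a ∷ as)) ≡ dropFlag j (false ∷ flags a 0 as)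
    after-𝔧 (inj₂ (j , last≡j , removed)) rewrite last≡j =
      inj₂ (suc j , refl , trans (cong (flags-step a (removeAt j as)) eq) (cong (false ∷_) removed))
    after-𝔧 (inj₁ last≡nothing) rewrite last≡nothing = inj₂ (0 , refl , rest-unchanged)
      where
      c≡0 : c ≡ 0
      c≡0 = ℕ.m+n≡0⇒n≡0 (a ∸ suc p) eq
      a≡1+p : a ≡ suc p
      a≡1+p = ℕ.≤-antisym (ℕ.m∸n≡0⇒m≤n (ℕ.m+n≡0⇒m≡0 (a ∸ suc p) eq)) p<a
      rest-unchanged : flags p c as ≡ flags a 0 as
      rest-unchanged rewrite c≡0 =
        trans (flags-rebase p a 0 as (ℕ.<⇒≤ p<a) as↑)
              (trans (cong (λ z → flags a z as) (trans (cong (_∸ p) a≡1+p) (ℕ.m+n∸n≡m 1 p)))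
                     (flags-+-AllTrue a 0 1 as (lastFalse-nothing⇒AllTrue _ last≡nothing)))
  ... | suc k = after-b (lastFalse-removable a k as as↑)
    where
    after-b : LastFalseRemovable a k as → lastFalse (true ∷ flags a k as) ≡ nothing ⊎
      Σ ℕ λ j → lastFalse (true ∷ flags a k as) ≡ just j ×
                flags p c (removeAt j (a ∷ as)) ≡ dropFlag j (true ∷ flags a k as)
    after-b (inj₂ (j , last≡j , removed)) rewrite last≡j =
      inj₂ (suc j , refl , trans (cong (flags-step a (removeAt j as)) eq) (cong (true ∷_) removed))
    after-b (inj₁ last≡nothing) rewrite last≡nothing = inj₁ refl

  minus≡ : ∀ F → Increasing 0 F → minus F ≡ maybe (λ i → removeAt i F) F (lastFalse (flags₀ F))
  minus≡ F F↑ = cong (maybe (λ i → removeAt i F) F)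
    (trans (lastNothing≡lastFalse 0 nothing (bseq F))
           (trans (cong (maybe just nothing ∘ lastFalse) (bseq≡flags F F↑)) (maybe-just (lastFalse (flags₀ F)))))
    where
    maybe-just : ∀ m → maybe just nothing m ≡ m
    maybe-just (just j) = refl
    maybe-just nothing  = refl

  select : List Bool → List ℕ → List ℕ
  select []           xs       = []
  select (b ∷ bs)     []       = []
  select (true ∷ bs)  (x ∷ xs) = x ∷ select bs xs
  select (false ∷ bs) (x ∷ xs) = select bs xs

  select-AllTrue : ∀ bs F → AllTrue bs → length bs ≡ length F → select bs F ≡ F
  select-AllTrue []          []      _       _ = refl
  select-AllTrue (true ∷ bs) (x ∷ F) (_ ∷ h) e = cong (x ∷_) (select-AllTrue bs F h (ℕ.suc-injective e))

  select-removeAt : ∀ (bs : List Bool) (F : List ℕ) j → lastFalse bs ≡ just j → length bs ≡ length F →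
    select (dropFlag j bs) (removeAt j F) ≡ select bs F
  select-removeAt (b ∷ bs) (x ∷ xs) j e |bs|≡ with lastFalse bs in eq
  select-removeAt (true ∷ bs)  (x ∷ xs) .(suc j) refl |bs|≡ | just j  =
    cong (x ∷_) (select-removeAt bs xs j eq (ℕ.suc-injective |bs|≡))
  select-removeAt (false ∷ bs) (x ∷ xs) .(suc j) refl |bs|≡ | just j  = select-removeAt bs xs j eq (ℕ.suc-injective |bs|≡)
  select-removeAt (false ∷ bs) (x ∷ xs) .0       refl |bs|≡ | nothing = refl
  select-removeAt (true ∷ bs)  (x ∷ xs) j        ()   |bs|≡ | nothing

  select-++ : ∀ bs cs F G → length bs ≡ length F → select (bs ++ cs) (F ++ G) ≡ select bs F ++ select cs G
  select-++ []           cs []      G _ = refl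
  select-++ (true ∷ bs)  cs (x ∷ F) G e = cong (x ∷_) (select-++ bs cs F G (ℕ.suc-injective e))
  select-++ (false ∷ bs) cs (x ∷ F) G e = select-++ bs cs F G (ℕ.suc-injective e)

  select-∉ : ∀ bs F y → mem y F ≡ false → mem y (select bs F) ≡ false
  select-∉ []           F       y y∉F = refl
  select-∉ (b ∷ bs)     []      y y∉F = refl
  select-∉ (true ∷ bs)  (x ∷ F) y y∉F with y ≡ᵇ x
  ... | true  = y∉F
  ... | false = select-∉ bs F y y∉F
  select-∉ (false ∷ bs) (x ∷ F) y y∉F with y ≡ᵇ x | y∉F
  ... | false | y∉F′ = select-∉ bs F y y∉F′

  iter-fixed : ∀ n (f : List ℕ → List ℕ) x → f x ≡ x → iter n f x ≡ x
  iter-fixed zero    f x fx≡x = refl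
  iter-fixed (suc n) f x fx≡x rewrite fx≡x = iter-fixed n f x fx≡x

  length-removeAt : ∀ j (F : List ℕ) → j < length F → suc (length (removeAt j F)) ≡ length F
  length-removeAt zero    (x ∷ F) _         = refl
  length-removeAt (suc j) (x ∷ F) (s≤s j<n) = cong suc (length-removeAt j F j<n)

  iter-minus≡select : ∀ n F → Increasing 0 F → length F ≤ n → iter n minus F ≡ select (flags₀ F) F
  iter-minus≡select zero    [] _  _     = refl
  iter-minus≡select (suc n) F  F↑ |F|≤n with lastFalse-removable 0 0 F F↑
  ... | inj₁ last≡nothing rewrite minus≡ F F↑ | last≡nothing =
    trans (iter-fixed n minus F (trans (minus≡ F F↑) (cong (maybe (λ i → removeAt i F) F) last≡nothing)))
          (sym (select-AllTrue (flags₀ F) F (lastFalse-nothing⇒AllTrue _ last≡nothing) (length-flags 0 0 F)))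
  ... | inj₂ (j , last≡j , removed) rewrite minus≡ F F↑ | last≡j =
    trans (iter-minus≡select n (removeAt j F) (Increasing-removeAt j F F↑) |F⁻|≤n)
          (trans (cong (λ bs → select bs (removeAt j F)) removed)
                 (select-removeAt (flags₀ F) F j last≡j (length-flags 0 0 F)))
    where
    |F⁻|≤n : length (removeAt j F) ≤ n
    |F⁻|≤n = ℕ.≤-pred (subst (_≤ suc n) (sym (length-removeAt j F
               (subst (j <_) (length-flags 0 0 F) (lastFalse<length (flags₀ F) j last≡j)))) |F|≤n)

  bar≡select : ∀ F → Increasing 0 F → bar F ≡ select (flags₀ F) F
  bar≡select F F↑ = iter-minus≡select (length F) F F↑ ℕ.≤-refl

  subsetᵇ-∷ʳ-∉ : ∀ A K w → mem w A ≡ false → subsetᵇ A (K ++ (w ∷ [])) ≡ subsetᵇ A K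
  subsetᵇ-∷ʳ-∉ []      K w _   = refl
  subsetᵇ-∷ʳ-∉ (x ∷ A) K w w∉A with w ≡ᵇ x in eq
  ... | false = cong₂ _∧_ (trans (mem-++ x K (w ∷ []))
                                 (trans (cong (λ b → mem x K ∨ (b ∨ false)) (trans (≡ᵇ-comm x w) eq))
                                        (Bool.∨-identityʳ (mem x K))))
                          (subsetᵇ-∷ʳ-∉ A K w w∉A)

  ∷ʳ-subsetᵇ : ∀ A K w → subsetᵇ (A ++ (w ∷ [])) K ≡ subsetᵇ A K ∧ mem w K
  ∷ʳ-subsetᵇ []      K w = Bool.∧-identityʳ (mem w K)
  ∷ʳ-subsetᵇ (x ∷ A) K w rewrite ∷ʳ-subsetᵇ A K w = sym (Bool.∧-assoc (mem x K) (subsetᵇ A K) (mem w K))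

  -- flagsEnd p c F: the last element of F and the number of free numbers left below it.
  mutual
    flagsEnd : ℕ → ℕ → List ℕ → ℕ × ℕ
    flagsEnd p c []       = p , c
    flagsEnd p c (a ∷ as) = flagsEnd-step a as ((a ∸ suc p) + c)

    flagsEnd-step : ℕ → List ℕ → ℕ → ℕ × ℕ
    flagsEnd-step a as zero    = flagsEnd a 0 as
    flagsEnd-step a as (suc k) = flagsEnd a k as

  flags-∷ʳ : ∀ p c xs w →
    flags p c (xs ++ (w ∷ [])) ≡ flags p c xs ++ flags (proj₁ (flagsEnd p c xs)) (proj₂ (flagsEnd p c xs)) (w ∷ [])
  flags-∷ʳ p c []       w = refl
  flags-∷ʳ p c (a ∷ as) w with (a ∸ suc p) + c
  ... | zero  = cong (false ∷_) (flags-∷ʳ a 0 as w)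
  ... | suc k = cong (true ∷_) (flags-∷ʳ a k as w)

  trues : List Bool → ℕ
  trues []           = 0
  trues (true ∷ bs)  = suc (trues bs)
  trues (false ∷ bs) = trues bs

  trues≤length : ∀ bs → trues bs ≤ length bs
  trues≤length []           = z≤n
  trues≤length (true ∷ bs)  = s≤s (trues≤length bs)
  trues≤length (false ∷ bs) = ℕ.m≤n⇒m≤1+n (trues≤length bs)

  -- Free numbers are created by the gaps and consumed by the b's.
  flagsEnd-invariant : ∀ p c xs → Increasing p xs →
    proj₂ (flagsEnd p c xs) + trues (flags p c xs) + length xs + p ≡ proj₁ (flagsEnd p c xs) + c
  flagsEnd-invariant p c []       _ = c+0+0+p≡p+c c p
    where c+0+0+p≡p+c : ∀ c p → c + 0 + 0 + p ≡ p + c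
          c+0+0+p≡p+c = solve-∀
  flagsEnd-invariant p c (a ∷ as) (cons p<a as↑) with (a ∸ suc p) + c in eq
  ... | zero = begin
      c′ + t + suc l + p ≡⟨ shift c′ t l p ⟩
      c′ + t + l + suc p ≡⟨ cong (c′ + t + l +_) (sym a≡1+p) ⟩
      c′ + t + l + a     ≡⟨ flagsEnd-invariant a 0 as as↑ ⟩
      p′ + 0             ≡⟨ cong (p′ +_) (sym c≡0) ⟩
      p′ + c             ∎
    where
    open ≡-Reasoning
    p′ = proj₁ (flagsEnd a 0 as)
    c′ = proj₂ (flagsEnd a 0 as)
    t = trues (flags a 0 as)
    l = length as
    c≡0 : c ≡ 0
    c≡0 = ℕ.m+n≡0⇒n≡0 (a ∸ suc p) eq
    a≡1+p : a ≡ suc p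
    a≡1+p = ℕ.≤-antisym (ℕ.m∸n≡0⇒m≤n (ℕ.m+n≡0⇒m≡0 (a ∸ suc p) eq)) p<a
    shift : ∀ c′ t l p → c′ + t + suc l + p ≡ c′ + t + l + suc p
    shift = solve-∀
  ... | suc k = ℕ.+-cancelʳ-≡ (suc k) _ _ (begin
      c′ + suc t + suc l + p + suc k   ≡⟨ cong (c′ + suc t + suc l + p +_) (sym eq) ⟩
      c′ + suc t + suc l + p + (d + c) ≡⟨ regroup c′ t l p d c ⟩
      c′ + t + l + (d + suc p) + suc c ≡⟨ cong (λ x → c′ + t + l + x + suc c) (ℕ.m∸n+n≡m p<a) ⟩
      c′ + t + l + a + suc c           ≡⟨ cong (_+ suc c) (flagsEnd-invariant a k as as↑) ⟩
      p′ + k + suc c                   ≡⟨ swap p′ k c ⟩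
      p′ + c + suc k                   ∎)
    where
    open ≡-Reasoning
    p′ = proj₁ (flagsEnd a k as)
    c′ = proj₂ (flagsEnd a k as)
    t = trues (flags a k as)
    l = length as
    d = a ∸ suc p
    regroup : ∀ c′ t l p d c → c′ + suc t + suc l + p + (d + c) ≡ c′ + t + l + (d + suc p) + suc c
    regroup = solve-∀
    swap : ∀ p′ k c → p′ + k + suc c ≡ p′ + c + suc k
    swap = solve-∀

  flagsEnd-≤ : ∀ T → Increasing 0 T → proj₂ (flagsEnd 0 0 T) ≡ 0 → proj₁ (flagsEnd 0 0 T) ≤ length T + length T
  flagsEnd-≤ T T↑ c′≡0 =
    subst (_≤ length T + length T) (sym last≡)
      (ℕ.+-monoˡ-≤ (length T) (subst (trues (flags₀ T) ≤_) (length-flags 0 0 T) (trues≤length (flags₀ T))))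
    where
    last≡ : proj₁ (flagsEnd 0 0 T) ≡ trues (flags₀ T) + length T
    last≡ = trans (sym (ℕ.+-identityʳ _))
              (trans (sym (flagsEnd-invariant 0 0 T T↑))
                     (trans (ℕ.+-identityʳ _) (cong (λ c′ → c′ + trues (flags₀ T) + length T) c′≡0)))

  bar-snoc : ∀ T w → Increasing 0 (T ++ (w ∷ [])) → suc (suc (length T + length T)) ≤ w →
    bar (T ++ (w ∷ [])) ≡ bar T ++ (w ∷ [])
  bar-snoc T w T∷ʳw↑ large =
    trans (bar≡select (T ++ (w ∷ [])) T∷ʳw↑)
    (trans (cong (λ bs → select bs (T ++ (w ∷ []))) (flags-∷ʳ 0 0 T w))
    (trans (cong (λ bs → select (flags₀ T ++ bs) (T ++ (w ∷ []))) last-flag)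
    (trans (select-++ (flags₀ T) (true ∷ []) T (w ∷ []) (length-flags 0 0 T))
           (cong (_++ (w ∷ [])) (sym (bar≡select T T↑))))))
    where
    T↑ = Increasing-++⁻ˡ T (w ∷ []) T∷ʳw↑
    p′ = proj₁ (flagsEnd 0 0 T)
    c′ = proj₂ (flagsEnd 0 0 T)
    last-flag : flags p′ c′ (w ∷ []) ≡ true ∷ []
    last-flag with (w ∸ suc p′) + c′ in eq
    ... | suc k = refl
    ... | zero  = ⊥-elim (ℕ.<⇒≱ (ℕ.<-≤-trans (s≤s (s≤s p′≤2|T|)) large) (ℕ.m∸n≡0⇒m≤n (ℕ.m+n≡0⇒m≡0 (w ∸ suc p′) eq)))
      where
      p′≤2|T| : p′ ≤ length T + length T
      p′≤2|T| = flagsEnd-≤ T T↑ (ℕ.m+n≡0⇒n≡0 (w ∸ suc p′) eq)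

  isSuc : ℕ → Bool
  isSuc zero    = false
  isSuc (suc _) = true

  1≤⇒isSuc : ∀ {x} → 1 ≤ x → isSuc x ≡ true
  1≤⇒isSuc {suc x} _ = refl

  nextCount : ℕ → ℕ → ℕ → ℕ
  nextCount p c a = pred ((a ∸ suc p) + c)

  flags-∷ : ∀ p c a xs → flags p c (a ∷ xs) ≡ isSuc ((a ∸ suc p) + c) ∷ flags a (nextCount p c a) xs
  flags-∷ p c a xs with (a ∸ suc p) + c
  ... | zero  = refl
  ... | suc k = refl

  flagsEnd-∷ : ∀ p c a xs → flagsEnd p c (a ∷ xs) ≡ flagsEnd a (nextCount p c a) xs
  flagsEnd-∷ p c a xs with (a ∸ suc p) + c
  ... | zero  = refl
  ... | suc k = refl

  flags-suc : ∀ p xs → flags p 0 (suc p ∷ xs) ≡ false ∷ flags (suc p) 0 xs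
  flags-suc p xs rewrite ℕ.n∸n≡0 p = refl

  -- insert𝔧 p c S inserts suc p right after the last point where the count is 0
  -- (so that it receives the last 𝔧); it fails if all later counts are positive.
  insert𝔧-∷ : ℕ → ℕ → ℕ → List ℕ → Maybe (List ℕ) → Maybe (List ℕ)
  insert𝔧-∷ p c       a as (just L) = just (a ∷ L)
  insert𝔧-∷ p zero    a as nothing  = just (suc p ∷ a ∷ as)
  insert𝔧-∷ p (suc c) a as nothing  = nothing

  insert𝔧-[] : ℕ → ℕ → Maybe (List ℕ)
  insert𝔧-[] p zero    = just (suc p ∷ [])
  insert𝔧-[] p (suc c) = nothing

  insert𝔧 : ℕ → ℕ → List ℕ → Maybe (List ℕ)
  insert𝔧 p c []       = insert𝔧-[] p c
  insert𝔧 p c (a ∷ as) = insert𝔧-∷ p c a as (insert𝔧 a (nextCount p c a) as)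

  insert𝔧-nothing⇒1≤count : ∀ p c S → insert𝔧 p c S ≡ nothing → 1 ≤ c
  insert𝔧-nothing⇒1≤count p zero    []       ()
  insert𝔧-nothing⇒1≤count p (suc c) []       _ = s≤s z≤n
  insert𝔧-nothing⇒1≤count p zero    (a ∷ as) e with insert𝔧 a (nextCount p zero a) as | e
  ... | just _  | ()
  ... | nothing | ()
  insert𝔧-nothing⇒1≤count p (suc c) (a ∷ as) _ = s≤s z≤n

  insert𝔧-nothing-tail : ∀ p c a as → insert𝔧 p c (a ∷ as) ≡ nothing → insert𝔧 a (nextCount p c a) as ≡ nothing
  insert𝔧-nothing-tail p c a as e with insert𝔧 a (nextCount p c a) as | e
  ... | just _  | ()
  ... | nothing | _ = refl

  flags-pred-count : ∀ a k as → insert𝔧 a k as ≡ nothing → flags a (pred k) as ≡ flags a k as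
  flags-pred-count a k       []       _ = refl
  flags-pred-count a k       (b ∷ bs) e with insert𝔧-nothing⇒1≤count a k (b ∷ bs) e | insert𝔧-nothing-tail a k b bs e
  flags-pred-count a (suc k) (b ∷ bs) e | s≤s z≤n | tail-nothing =
    trans (flags-∷ a k b bs)
    (trans (cong₂ _∷_ (1≤⇒isSuc 1≤m) (flags-pred-count b m bs tail-nothing′))
    (sym (trans (flags-∷ a (suc k) b bs) (cong (λ z → isSuc z ∷ flags b (pred z) bs) (ℕ.+-suc (b ∸ suc a) k)))))
    where
    m = (b ∸ suc a) + k
    tail-nothing′ : insert𝔧 b m bs ≡ nothing
    tail-nothing′ = subst (λ z → insert𝔧 b z bs ≡ nothing) (cong pred (ℕ.+-suc (b ∸ suc a) k)) tail-nothing
    1≤m : 1 ≤ m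
    1≤m = insert𝔧-nothing⇒1≤count b m bs tail-nothing′

  insert𝔧-nothing⇒AllTrue : ∀ p c S → insert𝔧 p c S ≡ nothing → AllTrue (flags p c S)
  insert𝔧-nothing⇒AllTrue p c []       _ = []
  insert𝔧-nothing⇒AllTrue p c (a ∷ as) e rewrite flags-∷ p c a as =
    1≤⇒isSuc (ℕ.≤-trans (insert𝔧-nothing⇒1≤count p c (a ∷ as) e) (ℕ.m≤n+m c (a ∸ suc p))) ∷
    insert𝔧-nothing⇒AllTrue a (nextCount p c a) as (insert𝔧-nothing-tail p c a as e)

  Room : ℕ → ℕ → ℕ → List ℕ → Set
  Room n p c S = proj₁ (flagsEnd p c S) < n ⊎ 1 ≤ proj₂ (flagsEnd p c S)

  Inserted : ℕ → ℕ → ℕ → List ℕ → List ℕ → Set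
  Inserted n p c S R = Σ ℕ λ j →
    lastFalse (flags p c R) ≡ just j × dropFlag j (flags p c R) ≡ flags p c S × removeAt j R ≡ S × Increasing≤ n p R

  insert𝔧-inserted : ∀ n p c S R → Increasing≤ n p S → Room n p c S → insert𝔧 p c S ≡ just R → Inserted n p c S R
  insert𝔧-inserted n p zero [] .(suc p ∷ []) [] (inj₁ p<n) refl rewrite flags-suc p [] =
    0 , refl , refl , refl , cons (ℕ.n<1+n p) p<n []
  insert𝔧-inserted n p zero    [] R [] (inj₂ ()) _
  insert𝔧-inserted n p (suc c) [] R [] _         ()
  insert𝔧-inserted n p c (a ∷ as) R (cons p<a a≤n as⊆) room e with insert𝔧 a (nextCount p c a) as in eq
  insert𝔧-inserted n p c (a ∷ as) .(a ∷ L) (cons p<a a≤n as⊆) room refl | just L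
    with insert𝔧-inserted n a (nextCount p c a) as L as⊆
           (subst (λ z → proj₁ z < n ⊎ 1 ≤ proj₂ z) (flagsEnd-∷ p c a as) room) eq
  ... | j , last≡j , dropped , removed , L⊆ rewrite flags-∷ p c a L | last≡j =
    suc j , refl , trans (cong (isSuc ((a ∸ suc p) + c) ∷_) dropped) (sym (flags-∷ p c a as)) ,
    cong (a ∷_) removed , cons p<a a≤n L⊆
  insert𝔧-inserted n p zero (a ∷ as) .(suc p ∷ a ∷ as) (cons p<a a≤n as⊆) _ refl | nothing =
    0 , last≡0 , trans (cong (dropFlag 0) (flags-suc p (a ∷ as))) shifted≡ , refl ,
    cons (ℕ.n<1+n p) (ℕ.<⇒≤ (ℕ.<-≤-trans 1+p<a a≤n)) (cons 1+p<a a≤n as⊆)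
    where
    g = a ∸ suc p
    rest-nothing : insert𝔧 a (pred g) as ≡ nothing
    rest-nothing = subst (λ z → insert𝔧 a (pred z) as ≡ nothing) (ℕ.+-identityʳ g) eq
    1≤pred-g : 1 ≤ pred g
    1≤pred-g = insert𝔧-nothing⇒1≤count a (pred g) as rest-nothing
    1≤g+0 : 1 ≤ g + 0
    1≤g+0 = ℕ.≤-trans 1≤pred-g (ℕ.≤-trans ℕ.pred[n]≤n (ℕ.m≤m+n g 0))
    1+p<a : suc p < a
    1+p<a = wide-gap a p 1≤pred-g
      where
      wide-gap : ∀ a p → 1 ≤ pred (a ∸ suc p) → suc p < a
      wide-gap (suc (suc a)) zero    _  = s≤s (s≤s z≤n)
      wide-gap (suc a)       (suc p) 1≤ = s≤s (wide-gap a p 1≤)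
      wide-gap (suc zero)    zero    ()
      wide-gap zero          p       ()
    shifted≡ : flags (suc p) 0 (a ∷ as) ≡ flags p 0 (a ∷ as)
    shifted≡ = begin
      flags (suc p) 0 (a ∷ as)
        ≡⟨ flags-∷ (suc p) 0 a as ⟩
      isSuc ((a ∸ suc (suc p)) + 0) ∷ flags a (pred ((a ∸ suc (suc p)) + 0)) as
        ≡⟨ cong (λ z → isSuc z ∷ flags a (pred z) as)
                (trans (ℕ.+-identityʳ _) (sym (ℕ.pred[m∸n]≡m∸[1+n] a (suc p)))) ⟩
      isSuc (pred g) ∷ flags a (pred (pred g)) as
        ≡⟨ cong₂ _∷_ (1≤⇒isSuc 1≤pred-g) (flags-pred-count a (pred g) as rest-nothing) ⟩
      true ∷ flags a (pred g) as
        ≡⟨ cong₂ _∷_ (sym (1≤⇒isSuc 1≤g+0)) (cong (λ z → flags a (pred z) as) (sym (ℕ.+-identityʳ g))) ⟩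
      isSuc (g + 0) ∷ flags a (pred (g + 0)) as
        ≡⟨ sym (flags-∷ p 0 a as) ⟩
      flags p 0 (a ∷ as) ∎
      where open ≡-Reasoning
    unshifted-AllTrue : AllTrue (flags p 0 (a ∷ as))
    unshifted-AllTrue = subst AllTrue (sym (flags-∷ p 0 a as))
                          (1≤⇒isSuc 1≤g+0 ∷ insert𝔧-nothing⇒AllTrue a (nextCount p 0 a) as eq)
    last≡0 : lastFalse (flags p 0 (suc p ∷ a ∷ as)) ≡ just 0
    last≡0 rewrite flags-suc p (a ∷ as)
                 | AllTrue⇒lastFalse-nothing _ (subst AllTrue (sym shifted≡) unshifted-AllTrue) = refl

  record MinusPreimage (n : ℕ) (S : List ℕ) : Set where
    field
      preimage        : List ℕ
      preimage-⊆      : Increasing≤ n 0 preimage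
      length-preimage : length preimage ≡ suc (length S)
      bar-preimage    : bar preimage ≡ bar S
      minus-preimage  : minus preimage ≡ S

  minus-preimage : ∀ n S → Increasing≤ n 0 S → suc (length S + length S) ≤ n → MinusPreimage n S
  minus-preimage n S S⊆ small with insert𝔧 0 0 S in eq
  ... | nothing = ⊥-elim (ℕ.<⇒≱ (insert𝔧-nothing⇒1≤count 0 0 S eq) z≤n)
  ... | just R with insert𝔧-inserted n 0 0 S R S⊆ room eq
    where
    room : Room n 0 0 S
    room with proj₂ (flagsEnd 0 0 S) in c′≡
    ... | suc _ = inj₂ (s≤s z≤n)
    ... | zero  = inj₁ (ℕ.≤-<-trans (flagsEnd-≤ S (Increasing≤⇒Increasing S⊆) c′≡) small)
  ... | j , last≡j , dropped , removed , R⊆ = record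
    { preimage = R ; preimage-⊆ = R⊆ ; length-preimage = length-R ; bar-preimage = bar-R ; minus-preimage = minus-R }
    where
    R↑ = Increasing≤⇒Increasing R⊆
    length-R : length R ≡ suc (length S)
    length-R = trans (sym (length-removeAt j R (subst (j <_) (length-flags 0 0 R) (lastFalse<length (flags₀ R) j last≡j))))
                     (cong (suc ∘ length) removed)
    bar-R : bar R ≡ bar S
    bar-R = trans (bar≡select R R↑) (trans (sym (select-removeAt (flags₀ R) R j last≡j (length-flags 0 0 R)))
                  (trans (cong₂ select dropped removed) (sym (bar≡select S (Increasing≤⇒Increasing S⊆)))))
    minus-R : minus R ≡ S
    minus-R = trans (minus≡ R R↑) (trans (cong (maybe (λ i → removeAt i R) R) last≡j) removed)


module Subsets where

  open import Data.Nat as ℕ using (zero; suc; _+_; _≤_; _<_; z≤n; s≤s)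
  import Data.Nat.Properties as ℕ
  open import Data.Nat.Combinatorics using (_C_; nCk+nC[k+1]≡[n+1]C[k+1])
  open import Data.Bool using (Bool; false)
  import Data.Bool.Properties as Bool
  open import Data.List using (List; []; _∷_; _++_; _∷ʳ_; map; length; lookup)
  import Data.List.Properties as List
  open import Data.List.Relation.Unary.All as All using (All; []; _∷_)
  import Data.List.Relation.Unary.All.Properties as All
  open import Data.List.Relation.Unary.Any using (here)
  open import Data.List.Relation.Unary.Unique.Propositional using (Unique; []; _∷_)
  import Data.List.Relation.Unary.Unique.Propositional.Properties as Unique
  open import Data.List.Membership.Propositional using (_∈_)
  open import Data.List.Membership.Propositional.Properties
    using (∈-lookup; ∈-map⁺; ∈-map⁻; ∈-++⁺ˡ; ∈-++⁺ʳ)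
  open import Data.Fin using (Fin)
  import Data.Fin as Fin
  open import Data.Product using (_×_; _,_; proj₁; ∃-syntax)
  open import Data.Sum using (_⊎_; inj₁; inj₂)
  open import Data.Empty using (⊥-elim)
  open import Relation.Binary.PropositionalEquality
  open import Relation.Nullary using (¬_; yes; no)
  open NatTests
  open Bar

  IsSubset : ℕ → ℕ → List ℕ → Set
  IsSubset v t T = Increasing≤ v 0 T × length T ≡ t

  length-∷ʳ : ∀ (T : List ℕ) w → length (T ∷ʳ w) ≡ suc (length T)
  length-∷ʳ T w = trans (List.length-++ T) (ℕ.+-comm (length T) 1)

  ksubsets-IsSubset : ∀ v t → All (IsSubset v t) (ksubsets v t)
  ksubsets-IsSubset zero    zero    = ([] , refl) ∷ []
  ksubsets-IsSubset zero    (suc t) = []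
  ksubsets-IsSubset (suc v) zero    = ([] , refl) ∷ []
  ksubsets-IsSubset (suc v) (suc t) =
    All.++⁺ (All.map (λ (T⊆ , |T|) → Increasing≤-weaken (ℕ.n≤1+n v) T⊆ , |T|) (ksubsets-IsSubset v (suc t)))
            (All.map⁺ (All.map (λ { {T} (T⊆ , |T|) →
                                    Increasing≤-∷ʳ T⊆ (s≤s z≤n) , trans (length-∷ʳ T (suc v)) (cong suc |T|) })
                               (ksubsets-IsSubset v t)))

  length-ksubsets : ∀ v t → length (ksubsets v t) ≡ v C t
  length-ksubsets zero    zero    = refl
  length-ksubsets zero    (suc t) = refl
  length-ksubsets (suc v) zero    = refl
  length-ksubsets (suc v) (suc t) = begin
    length (ksubsets v (suc t) ++ map (_∷ʳ suc v) (ksubsets v t))  ≡⟨ List.length-++ (ksubsets v (suc t)) ⟩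
    length (ksubsets v (suc t)) + length (map (_∷ʳ suc v) (ksubsets v t))
      ≡⟨ cong₂ _+_ (length-ksubsets v (suc t)) (trans (List.length-map _ (ksubsets v t)) (length-ksubsets v t)) ⟩
    v C suc t + v C t                                                ≡⟨ ℕ.+-comm (v C suc t) (v C t) ⟩
    v C t + v C suc t                                                ≡⟨ nCk+nC[k+1]≡[n+1]C[k+1] v t ⟩
    suc v C suc t                                                    ∎
    where open ≡-Reasoning

  ksubsets-nonempty : ∀ v k → k ≤ v → 1 ≤ length (ksubsets v k)
  ksubsets-nonempty zero    zero    _ = s≤s z≤n
  ksubsets-nonempty (suc v) zero    _ = s≤s z≤n
  ksubsets-nonempty (suc v) (suc k) (s≤s k≤v) =
    subst (1 ≤_) (sym (List.length-++ (ksubsets v (suc k))))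
      (ℕ.≤-trans (subst (1 ≤_) (sym (List.length-map (_∷ʳ suc v) (ksubsets v k))) (ksubsets-nonempty v k k≤v))
                 (ℕ.m≤n+m _ _))

  Increasing≤-top : ∀ v p T → Increasing≤ (suc v) p T →
    Increasing≤ v p T ⊎ (∃[ T′ ] T ≡ T′ ∷ʳ suc v × Increasing≤ v p T′)
  Increasing≤-top v p [] [] = inj₁ []
  Increasing≤-top v p (a ∷ as) (cons p<a a≤ T⊆) with Increasing≤-top v a as T⊆
  ... | inj₂ (T′ , refl , T′⊆) = inj₂ (a ∷ T′ , refl , cons p<a (ℕ.≤-pred (top T′ T⊆)) T′⊆)
    where
    top : ∀ {q} T′ → Increasing≤ (suc v) q (T′ ∷ʳ suc v) → q < suc v
    top []       (cons q< _ _)    = q<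
    top (x ∷ xs) (cons q< _ rest) = ℕ.<-trans q< (top xs rest)
  ... | inj₁ as⊆ with a ℕ.≟ suc v
  ...   | no  a≢ = inj₁ (cons p<a (ℕ.≤-pred (ℕ.≤∧≢⇒< a≤ a≢)) as⊆)
  ...   | yes refl = inj₂ ([] , cong (suc v ∷_) (nothing-above as T⊆) , [])
    where
    nothing-above : ∀ xs → Increasing≤ (suc v) (suc v) xs → xs ≡ []
    nothing-above []       _              = refl
    nothing-above (x ∷ xs) (cons v< x≤ _) = ⊥-elim (ℕ.<⇒≱ v< x≤)

  ksubsets-complete : ∀ v t T → IsSubset v t T → T ∈ ksubsets v t
  ksubsets-complete zero    zero    []       _                   = here refl
  ksubsets-complete zero    t       (a ∷ as) (cons 0<a a≤0 _ , _) = ⊥-elim (ℕ.<⇒≱ 0<a a≤0)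
  ksubsets-complete zero    (suc t) []       (_ , ())
  ksubsets-complete (suc v) zero    []       _                   = here refl
  ksubsets-complete (suc v) zero    (a ∷ as) (_ , ())
  ksubsets-complete (suc v) (suc t) T (T⊆ , |T|) with Increasing≤-top v 0 T T⊆
  ... | inj₁ T⊆v = ∈-++⁺ˡ (ksubsets-complete v (suc t) T (T⊆v , |T|))
  ... | inj₂ (T′ , refl , T′⊆) =
    ∈-++⁺ʳ (ksubsets v (suc t))
      (∈-map⁺ (_∷ʳ suc v) (ksubsets-complete v t T′ (T′⊆ , ℕ.suc-injective (trans (sym (length-∷ʳ T′ (suc v))) |T|))))

  mem-∷ʳ : ∀ w T → mem w (T ∷ʳ w) ≡ Bool.true
  mem-∷ʳ w T rewrite mem-++ w T (w ∷ []) | ≡ᵇ-refl w = Bool.∨-zeroʳ (mem w T)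

  ksubsets-unique : ∀ v t → Unique (ksubsets v t)
  ksubsets-unique zero    zero    = [] ∷ []
  ksubsets-unique zero    (suc t) = []
  ksubsets-unique (suc v) zero    = [] ∷ []
  ksubsets-unique (suc v) (suc t) =
    Unique.++⁺ (ksubsets-unique v (suc t)) (Unique.map⁺ (List.∷ʳ-injectiveˡ _ _) (ksubsets-unique v t)) disjoint
    where
    disjoint : ∀ {T} → ¬ (T ∈ ksubsets v (suc t) × T ∈ map (_∷ʳ suc v) (ksubsets v t))
    disjoint (T∈ , T∈′) with ∈-map⁻ (_∷ʳ suc v) T∈′
    ... | S , _ , refl with () ← trans (sym (mem-∷ʳ (suc v) S))
                                       (Increasing≤-mem-> (proj₁ (All.lookup (ksubsets-IsSubset v (suc t)) T∈)) (ℕ.n<1+n v))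

  Unique-lookup-injective : ∀ {A : Set} {xs : List A} → Unique xs → ∀ i j → lookup xs i ≡ lookup xs j → i ≡ j
  Unique-lookup-injective (x∉ ∷ u) Fin.zero    Fin.zero    e = refl
  Unique-lookup-injective (x∉ ∷ u) Fin.zero    (Fin.suc j) e = ⊥-elim (All.lookup x∉ (∈-lookup j) e)
  Unique-lookup-injective (x∉ ∷ u) (Fin.suc i) Fin.zero    e = ⊥-elim (All.lookup x∉ (∈-lookup i) (sym e))
  Unique-lookup-injective (x∉ ∷ u) (Fin.suc i) (Fin.suc j) e = cong Fin.suc (Unique-lookup-injective u i j e)

  bar⊆ᵇ : List ℕ → List ℕ → Bool
  bar⊆ᵇ T K = subsetᵇ (bar T) K

  module _ {v : ℕ} where

    bar-∌-top : ∀ {T} → Increasing≤ v 0 T → mem (suc v) (bar T) ≡ false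
    bar-∌-top {T} T⊆ rewrite bar≡select T (Increasing≤⇒Increasing T⊆) =
      select-∉ (flags₀ T) T (suc v) (Increasing≤-mem-> T⊆ (ℕ.n<1+n v))

    bar⊆ᵇ-∷ʳ-top : ∀ {T} K → Increasing≤ v 0 T → bar⊆ᵇ T (K ∷ʳ suc v) ≡ bar⊆ᵇ T K
    bar⊆ᵇ-∷ʳ-top {T} K T⊆ = subsetᵇ-∷ʳ-∉ (bar T) K (suc v) (bar-∌-top T⊆)

    bar-∷ʳ-top : ∀ {S} → Increasing≤ v 0 S → length S + length S < v → bar (S ∷ʳ suc v) ≡ bar S ∷ʳ suc v
    bar-∷ʳ-top {S} S⊆ small = bar-snoc S (suc v) (Increasing≤⇒Increasing (Increasing≤-∷ʳ S⊆ (s≤s z≤n))) (s≤s small)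

    ∷ʳ-top-bar⊆ᵇ : ∀ {S} K → Increasing≤ v 0 S → length S + length S < v → Increasing≤ v 0 K →
      bar⊆ᵇ (S ∷ʳ suc v) K ≡ false
    ∷ʳ-top-bar⊆ᵇ {S} K S⊆ small K⊆
      rewrite bar-∷ʳ-top S⊆ small | ∷ʳ-subsetᵇ (bar S) K (suc v) | Increasing≤-mem-> K⊆ (ℕ.n<1+n v) =
      Bool.∧-zeroʳ _

    ∷ʳ-top-bar⊆ᵇ-∷ʳ-top : ∀ {S} K → Increasing≤ v 0 S → length S + length S < v →
      bar⊆ᵇ (S ∷ʳ suc v) (K ∷ʳ suc v) ≡ bar⊆ᵇ S K
    ∷ʳ-top-bar⊆ᵇ-∷ʳ-top {S} K S⊆ small
      rewrite bar-∷ʳ-top S⊆ small | ∷ʳ-subsetᵇ (bar S) (K ∷ʳ suc v) (suc v) | mem-∷ʳ (suc v) K | bar⊆ᵇ-∷ʳ-top K S⊆ =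
      Bool.∧-identityʳ _


module BoolMatrices where

  open import Data.Bool using (Bool)
  open import Data.List using (List; []; _∷_; _++_; map; length; lookup)
  import Data.List.Properties as List
  open import Data.Fin as Fin using (Fin; splitAt; cast)
  open import Data.Fin.Properties using (cast-is-id)
  open import Data.Fin.Permutation using (cast-id)
  import Data.Fin.Permutation as Permutation
  open import Data.Sum using (inj₁; inj₂; [_,_]′)
  open import Relation.Binary.PropositionalEquality
  open Matrices
  open Blocks
  open SmithForm

  private variable A B : Set

  lookup-++ : ∀ (xs ys : List A) i →
    lookup (xs ++ ys) i ≡ [ lookup xs , lookup ys ]′ (splitAt (length xs) (cast (List.length-++ xs) i))
  lookup-++ []       ys i           = cong (lookup ys) (sym (cast-is-id _ i))
  lookup-++ (x ∷ xs) ys Fin.zero    = refl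
  lookup-++ (x ∷ xs) ys (Fin.suc i) with splitAt (length xs) (cast (List.length-++ xs) i) | lookup-++ xs ys i
  ... | inj₁ _ | e = e
  ... | inj₂ _ | e = e

  lookup-map : ∀ (f : A → B) (xs : List A) i → lookup (map f xs) i ≡ f (lookup xs (cast (List.length-map f xs) i))
  lookup-map f (x ∷ xs) Fin.zero    = refl
  lookup-map f (x ∷ xs) (Fin.suc i) = lookup-map f xs i

  boolMatrix : (List ℕ → List ℕ → Bool) → (R C : List (List ℕ)) → Matrix (length R) (length C)
  boolMatrix P R C i j = 𝟙 (P (lookup R i) (lookup C j))

  WideIO-boolMatrix-cong : ∀ P Q R C → (∀ i j → P (lookup R i) (lookup C j) ≡ Q (lookup R i) (lookup C j)) →
    WideIO (boolMatrix P R C) → WideIO (boolMatrix Q R C)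
  WideIO-boolMatrix-cong P Q R C P≡Q = WideIO-cong (λ i j → cong 𝟙 (P≡Q i j))

  WideIO-boolMatrix-++ : ∀ P R₁ R₂ C₁ C₂ →
    WideIO (block (boolMatrix P R₁ C₁) (boolMatrix P R₁ C₂) (boolMatrix P R₂ C₁) (boolMatrix P R₂ C₂)) →
    WideIO (boolMatrix P (R₁ ++ R₂) (C₁ ++ C₂))
  WideIO-boolMatrix-++ P R₁ R₂ C₁ C₂ M-IO =
    WideIO-cong (λ i j → sym (entry i j)) (WideIO-reindex (cast-id (List.length-++ R₁)) (cast-id (List.length-++ C₁)) M-IO)
    where
    entry : ∀ i j → boolMatrix P (R₁ ++ R₂) (C₁ ++ C₂) i j ≡
      block (boolMatrix P R₁ C₁) (boolMatrix P R₁ C₂) (boolMatrix P R₂ C₁) (boolMatrix P R₂ C₂)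
            (cast (List.length-++ R₁) i) (cast (List.length-++ C₁) j)
    entry i j rewrite lookup-++ R₁ R₂ i | lookup-++ C₁ C₂ j
      with splitAt (length R₁) (cast (List.length-++ R₁) i) | splitAt (length C₁) (cast (List.length-++ C₁) j)
    ... | inj₁ _ | inj₁ _ = refl
    ... | inj₁ _ | inj₂ _ = refl
    ... | inj₂ _ | inj₁ _ = refl
    ... | inj₂ _ | inj₂ _ = refl

  WideIO-boolMatrix-mapRows : ∀ P (f : List ℕ → List ℕ) R C →
    WideIO (boolMatrix (λ T K → P (f T) K) R C) → WideIO (boolMatrix P (map f R) C)
  WideIO-boolMatrix-mapRows P f R C M-IO =
    WideIO-cong (λ i j → cong 𝟙 (cong (λ T → P T (lookup C j)) (sym (lookup-map f R i))))
                (WideIO-reindex (cast-id (List.length-map f R)) Permutation.id M-IO)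

  WideIO-boolMatrix-mapColumns : ∀ P (g : List ℕ → List ℕ) R C →
    WideIO (boolMatrix (λ T K → P T (g K)) R C) → WideIO (boolMatrix P R (map g C))
  WideIO-boolMatrix-mapColumns P g R C M-IO =
    WideIO-cong (λ i j → cong 𝟙 (cong (P (lookup R i)) (sym (lookup-map g C j))))
                (WideIO-reindex Permutation.id (cast-id (List.length-map g C)) M-IO)


module FinInjections where

  open import Data.Nat using (suc)
  open import Data.Nat.Properties using (<-irrefl)
  open import Data.Fin using (Fin; punchOut)
  open import Data.Fin.Properties using (any?; _≟_; injective⇒≤; punchOut-injective)
  open import Data.Fin.Permutation using (Permutation′; _⟨$⟩ʳ_; permutation)
  open import Data.Product using (∃; Σ-syntax; _,_; proj₁; proj₂)
  open import Data.Empty using (⊥; ⊥-elim)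
  open import Relation.Binary.PropositionalEquality
  open import Relation.Nullary using (¬_; yes; no)

  injective⇒surjective : ∀ {n} {f : Fin n → Fin n} → (∀ {x y} → f x ≡ f y → x ≡ y) → ∀ y → ∃ λ x → f x ≡ y
  injective⇒surjective {n} {f} f-injective y with any? (λ x → f x ≟ y)
  ... | yes hit  = hit
  ... | no  miss = ⊥-elim (pigeonhole f-injective y miss)
    where
    pigeonhole : ∀ {n} {f : Fin n → Fin n} → (∀ {x y} → f x ≡ f y → x ≡ y) →
                 ∀ y → ¬ ∃ (λ x → f x ≡ y) → ⊥
    pigeonhole {suc m} {f} f-injective y miss = <-irrefl refl (injective⇒≤ squeeze-injective)
      where
      squeeze : Fin (suc m) → Fin m
      squeeze x = punchOut {i = y} {j = f x} (λ e → miss (x , sym e))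
      squeeze-injective : ∀ {x x′} → squeeze x ≡ squeeze x′ → x ≡ x′
      squeeze-injective {x} {x′} e =
        f-injective (punchOut-injective (λ e′ → miss (x , sym e′)) (λ e′ → miss (x′ , sym e′)) e)

  injective⇒permutation : ∀ {n} (f : Fin n → Fin n) → (∀ {x y} → f x ≡ f y → x ≡ y) →
    Σ[ π ∈ Permutation′ n ] (∀ i → π ⟨$⟩ʳ i ≡ f i)
  injective⇒permutation f f-injective =
    permutation f (λ y → proj₁ (hit y)) (λ y → proj₂ (hit y)) (λ x → f-injective (proj₂ (hit (f x)))) ,
    λ _ → refl
    where
    hit = injective⇒surjective f-injective


module Induction where

  open import Data.Nat as ℕ using (zero; suc; _+_; _≤_; _<_; _∸_; s≤s)
  import Data.Nat.Properties as ℕ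
  open import Data.Nat.Combinatorics using (_C_; nCk≡nC[n∸k])
  open import Data.List using (List; _∷ʳ_; map; length; lookup)
  import Data.List.Properties as List
  import Data.List.Relation.Unary.All as All
  import Data.List.Relation.Unary.Any as Any
  import Data.List.Relation.Unary.Any.Properties as Any
  open import Data.List.Membership.Propositional using (_∈_)
  open import Data.List.Membership.Propositional.Properties using (∈-lookup)
  open import Data.Fin as Fin using (Fin; toℕ; cast)
  import Data.Fin.Properties as Fin
  open import Data.Fin.Permutation using (_⟨$⟩ʳ_; cast-id; flip; inverseʳ)
  import Data.Fin.Permutation as Permutation
  open import Data.Integer using (0ℤ; 1ℤ; _-_)
  import Data.Integer.Properties as ℤ
  open import Data.Product using (_,_; proj₁; proj₂)
  open import Relation.Binary.PropositionalEquality
  open import Relation.Nullary using (yes; no)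
  open Matrices
  open Blocks
  open SmithForm
  open Bar
  open Subsets
  open BoolMatrices
  open FinInjections

  lookup-IsSubset : ∀ v t i → IsSubset v t (lookup (ksubsets v t) i)
  lookup-IsSubset v t i = All.lookup (ksubsets-IsSubset v t) (∈-lookup i)

  W-first-row : ∀ v k → k ≤ v → WideIO (W 0 k v)
  W-first-row zero    k k≤v = WideIO-cong {A = λ _ _ → 1ℤ} {A′ = W 0 k zero} (λ { Fin.zero j → refl })
                                (WideIO-ones (ksubsets-nonempty zero k k≤v))
  W-first-row (suc v) k k≤v = WideIO-cong {A = λ _ _ → 1ℤ} {A′ = W 0 k (suc v)} (λ { Fin.zero j → refl })
                                (WideIO-ones (ksubsets-nonempty (suc v) k k≤v))

  module Step (v t k : ℕ) (IH : ∀ t k → t ≤ k → k + t ≤ v → WideIO (W t k v))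
              (t≤k : t ≤ k) (bound : suc k + suc t ≤ suc v) where

    extend : List ℕ → List ℕ
    extend S = S ∷ʳ suc v

    R₁ = ksubsets v (suc t)
    R₂ = ksubsets v t
    C₁ = ksubsets v (suc k)
    C₂ = ksubsets v k

    A₀ = boolMatrix bar⊆ᵇ R₁ C₁
    B₀ = boolMatrix bar⊆ᵇ R₁ (map extend C₂)
    D₀ = boolMatrix bar⊆ᵇ (map extend R₂) (map extend C₂)

    k+t≤v : k + t ≤ v
    k+t≤v = ℕ.≤-trans (ℕ.+-monoʳ-≤ k (ℕ.n≤1+n t)) (ℕ.≤-pred bound)

    small : ∀ i → length (lookup R₂ i) + length (lookup R₂ i) < v
    small i rewrite proj₂ (lookup-IsSubset v t i) =
      ℕ.≤-trans (ℕ.≤-reflexive (sym (ℕ.+-suc t t))) (ℕ.≤-trans (ℕ.+-monoˡ-≤ (suc t) t≤k) (ℕ.≤-pred bound))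

    lower-left≐0 : boolMatrix bar⊆ᵇ (map extend R₂) C₁ ≐ 0M
    lower-left≐0 i j = cong 𝟙 (trans (cong (λ T → bar⊆ᵇ T (lookup C₁ j)) (lookup-map extend R₂ i))
                                (∷ʳ-top-bar⊆ᵇ (lookup C₁ j) (proj₁ (lookup-IsSubset v t i′)) (small i′)
                                              (proj₁ (lookup-IsSubset v (suc k) j))))
      where i′ = cast (List.length-map extend R₂) i

    W-from-block : WideIO (block A₀ B₀ 0M D₀) → WideIO (W (suc t) (suc k) (suc v))
    W-from-block M-IO = WideIO-boolMatrix-++ bar⊆ᵇ R₁ (map extend R₂) C₁ (map extend C₂)
                          (WideIO-cong (block-cong ≐-refl ≐-refl (≐-sym lower-left≐0) ≐-refl) M-IO)

    D₀-WideIO : WideIO D₀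
    D₀-WideIO = WideIO-boolMatrix-mapRows bar⊆ᵇ extend R₂ (map extend C₂)
                  (WideIO-boolMatrix-mapColumns (λ T K → bar⊆ᵇ (extend T) K) extend R₂ C₂
                    (WideIO-boolMatrix-cong bar⊆ᵇ (λ T K → bar⊆ᵇ (extend T) (extend K)) R₂ C₂
                      (λ i j → sym (∷ʳ-top-bar⊆ᵇ-∷ʳ-top (lookup C₂ j) (proj₁ (lookup-IsSubset v t i)) (small i)))
                      (IH t k t≤k k+t≤v)))

    B₀-WideIO : WideIO (boolMatrix bar⊆ᵇ R₁ C₂) → WideIO B₀
    B₀-WideIO B-IO = WideIO-boolMatrix-mapColumns bar⊆ᵇ extend R₁ C₂
                       (WideIO-boolMatrix-cong bar⊆ᵇ (λ T K → bar⊆ᵇ T (extend K)) R₁ C₂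
                         (λ i j → sym (bar⊆ᵇ-∷ʳ-top (lookup C₂ j) (proj₁ (lookup-IsSubset v (suc t) i)))) B-IO)

    interior : suc k + suc t ≤ v → WideIO (W (suc t) (suc k) (suc v))
    interior fits = W-from-block (WideIO-upper B₀ (IH (suc t) (suc k) (s≤s t≤k) fits) D₀-WideIO)

    -- When k + t = v the top-left block is not covered by induction. Instead each
    -- S ∈ R₂ equals R⁻ for some R ∈ R₁ with R̄ = S̄ (minus-preimage); subtracting row R
    -- from row S ∪ {v+1} clears the bottom-right block and leaves rows of W t (suc k) v.
    module Boundary (tight : suc k + suc t ≡ suc v) where

      preimage-of : ∀ i → MinusPreimage v (lookup R₂ i)
      preimage-of i = minus-preimage v (lookup R₂ i) (proj₁ (lookup-IsSubset v t i)) (small i)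

      preimage-∈ : ∀ i → MinusPreimage.preimage (preimage-of i) ∈ R₁
      preimage-∈ i = ksubsets-complete v (suc t) _
                       (preimage-⊆ , trans length-preimage (cong suc (proj₂ (lookup-IsSubset v t i))))
        where open MinusPreimage (preimage-of i)

      π₀ : Fin (length R₂) → Fin (length R₁)
      π₀ i = Any.index (preimage-∈ i)

      lookup-π₀ : ∀ i → lookup R₁ (π₀ i) ≡ MinusPreimage.preimage (preimage-of i)
      lookup-π₀ i = sym (Any.lookup-index (preimage-∈ i))

      bar-π₀ : ∀ i → bar (lookup R₁ (π₀ i)) ≡ bar (lookup R₂ i)
      bar-π₀ i = trans (cong bar (lookup-π₀ i)) (MinusPreimage.bar-preimage (preimage-of i))

      minus-π₀ : ∀ i → minus (lookup R₁ (π₀ i)) ≡ lookup R₂ i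
      minus-π₀ i = trans (cong minus (lookup-π₀ i)) (MinusPreimage.minus-preimage (preimage-of i))

      π₀-injective : ∀ {i i′} → π₀ i ≡ π₀ i′ → i ≡ i′
      π₀-injective {i} {i′} e = Unique-lookup-injective (ksubsets-unique v t) i i′
        (trans (sym (minus-π₀ i)) (trans (cong (λ l → minus (lookup R₁ l)) e) (minus-π₀ i′)))

      |R₂|≡ : length (map extend R₂) ≡ length R₂
      |R₂|≡ = List.length-map extend R₂

      π : Fin (length (map extend R₂)) → Fin (length R₁)
      π i = π₀ (cast |R₂|≡ i)

      A′ : Matrix (length (map extend R₂)) (length C₁)
      A′ i j = A₀ (π i) j

      A′-WideIO : WideIO A′
      A′-WideIO =
        WideIO-cong (λ i j → cong (λ T → 𝟙 (subsetᵇ T (lookup C₁ j))) (sym (bar-π₀ (cast |R₂|≡ i))))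
          (WideIO-reindex (cast-id |R₂|≡) Permutation.id
            (IH t (suc k) (ℕ.m≤n⇒m≤1+n t≤k) (ℕ.≤-reflexive (trans (sym (ℕ.+-suc k t)) (ℕ.suc-injective tight)))))

      B-WideIO : WideIO (boolMatrix bar⊆ᵇ R₁ C₂)
      B-WideIO with suc t ℕ.≤? k
      ... | yes t<k = IH (suc t) k t<k (ℕ.≤-reflexive (ℕ.suc-injective tight))
      ... | no  t≮k = WideIO-cong restore (WideIO-reindex (flip ρ) Permutation.id rows-permuted)
        where
        k≡t : k ≡ t
        k≡t = ℕ.≤-antisym (ℕ.≮⇒≥ t≮k) t≤k
        v≡t+[1+t] : v ≡ t + suc t
        v≡t+[1+t] = trans (sym (ℕ.suc-injective tight)) (cong (_+ suc t) k≡t)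
        |R₂|≡|R₁| : length R₂ ≡ length R₁
        |R₂|≡|R₁| = begin
          length R₂         ≡⟨ length-ksubsets v t ⟩
          v C t             ≡⟨ nCk≡nC[n∸k] (subst (t ≤_) (sym v≡t+[1+t]) (ℕ.m≤m+n t (suc t))) ⟩
          v C (v ∸ t)       ≡⟨ cong (λ n → v C (n ∸ t)) v≡t+[1+t] ⟩
          v C (t + suc t ∸ t) ≡⟨ cong (v C_) (ℕ.m+n∸m≡n t (suc t)) ⟩
          v C suc t         ≡⟨ sym (length-ksubsets v (suc t)) ⟩
          length R₁         ∎
          where open ≡-Reasoning
        cast-injective : ∀ {x y} → cast (sym |R₂|≡|R₁|) x ≡ cast (sym |R₂|≡|R₁|) y → x ≡ y
        cast-injective {x} {y} e =
          Fin.toℕ-injective (trans (sym (Fin.toℕ-cast _ x)) (trans (cong toℕ e) (Fin.toℕ-cast _ y)))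
        ρ = proj₁ (injective⇒permutation (λ l → π₀ (cast (sym |R₂|≡|R₁|) l))
                     (λ e → cast-injective (π₀-injective e)))
        rows-permuted : WideIO (λ i j → boolMatrix bar⊆ᵇ R₁ C₂ (ρ ⟨$⟩ʳ i) j)
        rows-permuted =
          WideIO-cong (λ i j → cong (λ T → 𝟙 (subsetᵇ T (lookup C₂ j))) (sym (bar-π₀ (cast (sym |R₂|≡|R₁|) i))))
            (WideIO-reindex (cast-id (sym |R₂|≡|R₁|)) Permutation.id (IH t k t≤k k+t≤v))
        restore : (λ i j → boolMatrix bar⊆ᵇ R₁ C₂ (ρ ⟨$⟩ʳ (flip ρ ⟨$⟩ʳ i)) j) ≐ boolMatrix bar⊆ᵇ R₁ C₂
        restore i j = cong (λ l → boolMatrix bar⊆ᵇ R₁ C₂ l j) (inverseʳ ρ)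

      B₀∘π≐D₀ : ∀ i j → B₀ (π i) j ≡ D₀ i j
      B₀∘π≐D₀ i j = cong 𝟙 (begin
        bar⊆ᵇ (lookup R₁ (π i)) (lookup (map extend C₂) j) ≡⟨ cong₂ subsetᵇ (bar-π₀ i′) (lookup-map extend C₂ j) ⟩
        bar⊆ᵇ S (extend K)                                 ≡⟨ bar⊆ᵇ-∷ʳ-top K S⊆ ⟩
        bar⊆ᵇ S K                                       ≡⟨ sym (∷ʳ-top-bar⊆ᵇ-∷ʳ-top K S⊆ (small i′)) ⟩
        bar⊆ᵇ (extend S) (extend K)
          ≡⟨ sym (cong₂ bar⊆ᵇ (lookup-map extend R₂ i) (lookup-map extend C₂ j)) ⟩
        bar⊆ᵇ (lookup (map extend R₂) i) (lookup (map extend C₂) j) ∎)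
        where
        open ≡-Reasoning
        i′ = cast |R₂|≡ i
        S = lookup R₂ i′
        K = lookup C₂ (cast (List.length-map extend C₂) j)
        S⊆ = proj₁ (lookup-IsSubset v t i′)

      boundary : WideIO (W (suc t) (suc k) (suc v))
      boundary =
        W-from-block (WideIO-rowReduce π {A₀} {B₀} {0M} {D₀} (WideIO-cong reduced
          (WideIO-antidiagonal A₀ (B₀-WideIO B-WideIO) (WideIO-neg A′-WideIO))))
        where
        reduced : block A₀ B₀ (neg A′) 0M ≐ block A₀ B₀ (λ i j → 0ℤ - A₀ (π i) j) (λ i j → D₀ i j - B₀ (π i) j)
        reduced = block-cong ≐-refl ≐-refl (λ i j → sym (ℤ.+-identityˡ _))
                    (λ i j → sym (trans (cong (D₀ i j -_) (B₀∘π≐D₀ i j)) (ℤ.+-inverseʳ (D₀ i j))))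

  W-WideIO : ∀ v t k → t ≤ k → k + t ≤ v → WideIO (W t k v)
  W-WideIO v       zero    k       _   k+0≤v = W-first-row v k (subst (_≤ v) (ℕ.+-identityʳ k) k+0≤v)
  W-WideIO zero    (suc t) k       _   bound with () ← subst (_≤ 0) (ℕ.+-suc k t) bound
  W-WideIO (suc v) (suc t) zero    ()  _
  W-WideIO (suc v) (suc t) (suc k) t≤k bound with suc k + suc t ℕ.≤? v
  ... | yes fits = interior fits
    where open Step v t k (λ t k → W-WideIO v t k) (ℕ.≤-pred t≤k) bound
  ... | no  nofit = boundary
    where open Step v t k (λ t k → W-WideIO v t k) (ℕ.≤-pred t≤k) bound
          open Boundary (ℕ.≤-antisym bound (ℕ.≰⇒> nofit))


open import Data.Nat using (_≤_; _+_)
open import Data.Product using (proj₂)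

theorem4p1 : (t k v : ℕ) → t ≤ k → k + t ≤ v → SNFisIO (W t k v)
theorem4p1 t k v t≤k k+t≤v = proj₂ (Induction.W-WideIO v t k t≤k k+t≤v)
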